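{- Let $p$ be prime and let $1\leq r\leq p-1$ be an integer such that $12r+1$ is a quadratic nonresidue modulo $p$. Then for all integers $m\geq 0$, $\overline{C}_{4,1}(pm+r)\equiv 0\pmod 2$.
   Context: An overpartition of $n$ is a partition of $n$ in which the first occurrence of each distinct part may optionally be overlined. $\overline{C}_{4,1}(n)$ denotes the number of overpartitions of $n$ in which no part is divisible by $4$ and only parts congruent to $\pm 1 \pmod{4}$ may be overlined; equivalently $\sum_{n\ge0}\overline{C}_{4,1}(n)q^n=\frac{(q^4;q^4)_\infty(-q;q^4)_\infty(-q^3;q^4)_\infty}{(q;q)_\infty}$, where $(A;q)_\infty=\prod_{j\ge0}(1-Aq^j)$. -}

module Defs where

open import Data.Nat using (ℕ; zero; suc; _+_; _*_; _∸_; _≤ᵇ_; _%_; _≡ᵇ_)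
open import Data.Bool using (if_then_else_)
open import Data.List using (List; upTo; map)
open import Data.Nat.ListAction using (sum)
open import Data.Product using (∃-syntax)
open import Data.Integer as ℤ using (ℤ; +_)
open import Data.Integer.Divisibility as ℤD using ()
open import Relation.Nullary using (¬_)

-- Weight contributed by part size s used with multiplicity j in an
-- overpartition counted by C̄_{4,1}:
--   j = 0            : 1  (part absent)
--   s ≡ 0 (mod 4)    : 0  (parts divisible by 4 forbidden)
--   s ≡ ±1 (mod 4)   : 2  (first occurrence overlined or not)
--   s ≡ 2 (mod 4)    : 1  (may not be overlined)
weight : ℕ → ℕ → ℕ
weight s zero    = 1
weight s (suc j) with s % 4
... | 0 = 0
... | 2 = 1
... | _ = 2

-- cnt n k = number of overpartitions of n of the C̄_{4,1} kind
-- all of whose parts are ≤ k (enumerating the multiplicity j of the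
-- largest allowed part size k).
cnt : ℕ → ℕ → ℕ
cnt n zero    = if n ≡ᵇ 0 then 1 else 0
cnt n (suc k) =
  sum (map (λ j → if (j * suc k) ≤ᵇ n
                    then weight (suc k) j * cnt (n ∸ j * suc k) k
                    else 0)
           (upTo (suc n)))

-- C̄_{4,1}(n): all parts are ≤ n.
Cbar41 : ℕ → ℕ
Cbar41 n = cnt n n

QuadraticResidue : ℕ → ℕ → Set
QuadraticResidue p a = ∃[ x ] ((+ p) ℤD.∣ (x ℤ.* x ℤ.- + a))

QuadraticNonResidue : ℕ → ℕ → Set
QuadraticNonResidue p a = ¬ QuadraticResidue p a

open import Relation.Binary.PropositionalEquality using (_≡_; refl)
open import Data.List using (_∷_; [])
_ : map Cbar41 (upTo 8) ≡ 1 ∷ 2 ∷ 3 ∷ 6 ∷ 9 ∷ 14 ∷ 22 ∷ 32 ∷ []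
_ = refl

module Submission where

-- Modulo 2 we have (-q;q⁴)(-q³;q⁴) ≡ (q;q²) and hence
--   Σ C̄₄,₁(n) qⁿ ≡ (q⁴;q⁴)/(q²;q²) ≡ (-q²;q²)_∞   (mod 2).
-- So C̄₄,₁(n) is even for odd n, and C̄₄,₁(2N) has the parity of the number
-- of partitions of N into distinct parts.  Franklin's involution on such
-- partitions preserves the size, and its fixed points have pentagonal
-- shape; hence this number is odd only if N = k(3k ± 1)/2, i.e. only if
-- 24N + 1 = 12·(2N) + 1 is a perfect square.  Finally 12(pm + r) + 1 ≡
-- 12r + 1 (mod p), so a square would make 12r + 1 a quadratic residue.

open import Defs
open import Data.Nat using (ℕ; _+_; _*_; _≤_; _∸_)
open import Data.Nat.Primality using (Prime)
open import Data.Nat.Divisibility using (_∣_)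

open import Data.Nat
open import Data.Nat.Properties
open import Data.Nat.ListAction using (sum)
open import Data.Nat.DivMod using (m≡m%n+[m/n]*n; m%n<n; [m+kn]%n≡m%n)
open import Data.Nat.Tactic.RingSolver
open import Data.Nat.Divisibility using (divides)
open import Data.Bool using (Bool; true; false; not; _∧_; _xor_; if_then_else_)
open import Data.Bool.Properties using (not-distribˡ-xor; xor-assoc; xor-same; xor-identityʳ; ∧-zeroʳ; not-involutive; if-float; T-≡; xor-∧-commutativeRing)
open import Data.List using (List; []; _∷_; map; foldr; upTo; applyUpTo; _++_)
open import Data.List.Properties using (map-∘; map-cong; map-++)
open import Data.Nat.ListAction.Properties using (sum-++)
open import Data.Vec using (Vec; []; _∷_)
open import Data.Integer as ℤ using (ℤ)
open import Data.Integer.Properties using (pos-*; m-n≡m⊖n; ⊖-≥)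
open import Relation.Binary.PropositionalEquality
open import Relation.Binary.Bundles using (Setoid)
import Relation.Binary.Reasoning.Setoid as SetoidReasoning
open import Relation.Nullary using (yes; no; ¬_; Dec)
open import Relation.Nullary.Decidable using (_×-dec_)
open import Data.Product using (∃; _×_; _,_; proj₁; proj₂)
open import Data.Sum using (_⊎_; inj₁; inj₂)
open import Data.Empty using (⊥-elim)
open import Function using (_∘_; id)
open import Function.Bundles using (Equivalence)
open import Algebra.Bundles using (CommutativeRing)
open import Algebra.Properties.CommutativeSemigroup
  (CommutativeRing.+-commutativeSemigroup xor-∧-commutativeRing) using (interchange)

open Equivalence using (to; from)

-- Parity of natural numbers, as a homomorphism ℕ → F₂ (Bool with xor, ∧).

isOdd : ℕ → Bool
isOdd zero = false
isOdd (suc n) = not (isOdd n)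

isOdd-+ : ∀ m n → isOdd (m + n) ≡ isOdd m xor isOdd n
isOdd-+ zero n = refl
isOdd-+ (suc m) n rewrite isOdd-+ m n = not-distribˡ-xor (isOdd m) (isOdd n)

isOdd-* : ∀ m n → isOdd (m * n) ≡ isOdd m ∧ isOdd n
isOdd-* zero n = refl
isOdd-* (suc m) n rewrite isOdd-+ n (m * n) | isOdd-* m n = xor-absorb (isOdd m) (isOdd n)
  where
  xor-absorb : ∀ a b → b xor (a ∧ b) ≡ not a ∧ b
  xor-absorb false b = xor-identityʳ b
  xor-absorb true b = xor-same b

isOdd-double : ∀ n → isOdd (n + n) ≡ false
isOdd-double n = trans (isOdd-+ n n) (xor-same (isOdd n))

even⇒2∣ : ∀ n → isOdd n ≡ false → 2 ∣ n
even⇒2∣ zero _ = divides 0 refl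
even⇒2∣ (suc zero) ()
even⇒2∣ (suc (suc n)) e with even⇒2∣ n (trans (sym (not-involutive (isOdd n))) e)
... | divides q eq = divides (suc q) (cong (suc ∘ suc) eq)

xorAll : List Bool → Bool
xorAll = foldr _xor_ false

isOdd-sum : ∀ xs → isOdd (sum xs) ≡ xorAll (map isOdd xs)
isOdd-sum [] = refl
isOdd-sum (x ∷ xs) rewrite isOdd-+ x (sum xs) | isOdd-sum xs = refl

≤ᵇ-true : ∀ {m n} → m ≤ n → (m ≤ᵇ n) ≡ true
≤ᵇ-true m≤n = to T-≡ (≤⇒≤ᵇ m≤n)

≤ᵇ-false : ∀ {m n} → n < m → (m ≤ᵇ n) ≡ false
≤ᵇ-false {m} {n} n<m with m ≤ᵇ n in eq
... | true = ⊥-elim (<⇒≱ n<m (≤ᵇ⇒≤ m n (from T-≡ eq)))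
... | false = refl

<ᵇ-suc : ∀ m n → (m <ᵇ suc n) ≡ (m ≤ᵇ n)
<ᵇ-suc zero n = refl
<ᵇ-suc (suc m) n = refl

+-cancel-≤ᵇ : ∀ s x y → (s + x ≤ᵇ s + y) ≡ (x ≤ᵇ y)
+-cancel-≤ᵇ zero x y = refl
+-cancel-≤ᵇ (suc s) x y = trans (<ᵇ-suc (s + x) (s + y)) (+-cancel-≤ᵇ s x y)

≡ᵇ-refl : ∀ n → (n ≡ᵇ n) ≡ true
≡ᵇ-refl n = to T-≡ (≡⇒≡ᵇ n n refl)

≡ᵇ-true : ∀ m n → (m ≡ᵇ n) ≡ true → m ≡ n
≡ᵇ-true m n e = ≡ᵇ⇒≡ m n (from T-≡ e)

≢⇒≡ᵇ-false : ∀ {m n} → m ≢ n → (m ≡ᵇ n) ≡ false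
≢⇒≡ᵇ-false {m} {n} m≢n with m ≡ᵇ n in eq
... | true = ⊥-elim (m≢n (≡ᵇ-true m n eq))
... | false = refl

true≢false : true ≢ false
true≢false ()

-- Formal power series over F₂, represented by their coefficient functions
-- and compared pointwise (_≗_).

Series : Set
Series = ℕ → Bool

module ≗-Reasoning = SetoidReasoning (ℕ →-setoid Bool)
open Setoid (ℕ →-setoid Bool) using () renaming (refl to ≗-refl; sym to ≗-sym; trans to ≗-trans)

unit : Series
unit n = n ≡ᵇ 0

shift : ℕ → Series → Series
shift t f n = if t ≤ᵇ n then f (n ∸ t) else false

times1+ : ℕ → Series → Series
times1+ t f n = f n xor shift t f n

shift-cong : ∀ t {f g} → f ≗ g → shift t f ≗ shift t g
shift-cong t {f} {g} e n with t ≤ᵇ n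
... | true = e (n ∸ t)
... | false = refl

times1+-cong : ∀ t {f g} → f ≗ g → times1+ t f ≗ times1+ t g
times1+-cong t e n = cong₂ _xor_ (e n) (shift-cong t e n)

shift-xor : ∀ t f g n → shift t (λ m → f m xor g m) n ≡ shift t f n xor shift t g n
shift-xor t f g n with t ≤ᵇ n
... | true = refl
... | false = refl

shift-shift : ∀ t u f n → shift t (shift u f) n ≡ shift (t + u) f n
shift-shift t u f n with t ≤? n
... | no t≰n rewrite ≤ᵇ-false (≰⇒> t≰n) | ≤ᵇ-false {t + u} {n} (<-≤-trans (≰⇒> t≰n) (m≤m+n t u)) = refl
... | yes t≤n = subst (λ n → shift t (shift u f) n ≡ shift (t + u) f n) (m+[n∸m]≡n t≤n) (shifted (n ∸ t))
  where
  shifted : ∀ n' → shift t (shift u f) (t + n') ≡ shift (t + u) f (t + n')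
  shifted n' rewrite ≤ᵇ-true (m≤m+n t n') | m+n∸m≡n t n' | +-cancel-≤ᵇ t u n' | [m+n]∸[m+o]≡n∸o t n' u = refl

shift-low : ∀ t f n → n < t → shift t f n ≡ false
shift-low t f n p rewrite ≤ᵇ-false p = refl

times1+-low : ∀ t f n → n < t → times1+ t f n ≡ f n
times1+-low t f n p rewrite shift-low t f n p = xor-identityʳ (f n)

times1+-twice : ∀ t u f n → times1+ t (times1+ u f) n ≡ (f n xor shift u f n) xor (shift t f n xor shift (t + u) f n)
times1+-twice t u f n = cong ((f n xor shift u f n) xor_)
  (trans (shift-xor t f (shift u f) n) (cong (shift t f n xor_) (shift-shift t u f n)))

times1+-comm : ∀ t u f → times1+ t (times1+ u f) ≗ times1+ u (times1+ t f)
times1+-comm t u f n = begin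
  times1+ t (times1+ u f) n
    ≡⟨ times1+-twice t u f n ⟩
  (f n xor shift u f n) xor (shift t f n xor shift (t + u) f n)
    ≡⟨ interchange (f n) (shift u f n) (shift t f n) (shift (t + u) f n) ⟩
  (f n xor shift t f n) xor (shift u f n xor shift (t + u) f n)
    ≡⟨ cong (λ x → (f n xor shift t f n) xor (shift u f n xor shift x f n)) (+-comm t u) ⟩
  (f n xor shift t f n) xor (shift u f n xor shift (u + t) f n)
    ≡⟨ times1+-twice u t f n ⟨
  times1+ u (times1+ t f) n ∎
  where open ≡-Reasoning

-- Frobenius in characteristic 2: (1 + qᵗ)² = 1 + q²ᵗ.
times1+-square : ∀ t f → times1+ t (times1+ t f) ≗ times1+ (t + t) f
times1+-square t f n = begin
  times1+ t (times1+ t f) n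
    ≡⟨ times1+-twice t t f n ⟩
  (f n xor shift t f n) xor (shift t f n xor shift (t + t) f n)
    ≡⟨ xor-assoc (f n) (shift t f n) _ ⟩
  f n xor (shift t f n xor (shift t f n xor shift (t + t) f n))
    ≡⟨ cong (f n xor_) (xor-assoc (shift t f n) (shift t f n) _) ⟨
  f n xor ((shift t f n xor shift t f n) xor shift (t + t) f n)
    ≡⟨ cong (λ x → f n xor (x xor shift (t + t) f n)) (xor-same (shift t f n)) ⟩
  times1+ (t + t) f n ∎
  where open ≡-Reasoning

-- If H = f + qᵗH, i.e. H = f/(1 - qᵗ), then (1 + qᵗ)H = f.
times1+-geometric : ∀ t f H → (∀ n → H n ≡ f n xor shift t H n) → times1+ t H ≗ f
times1+-geometric t f H e n = begin
  H n xor shift t H n                 ≡⟨ cong (_xor shift t H n) (e n) ⟩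
  (f n xor shift t H n) xor shift t H n ≡⟨ xor-assoc (f n) _ _ ⟩
  f n xor (shift t H n xor shift t H n) ≡⟨ cong (f n xor_) (xor-same (shift t H n)) ⟩
  f n xor false                       ≡⟨ xor-identityʳ (f n) ⟩
  f n ∎
  where open ≡-Reasoning

-- By Defs, cnt n (k+1) = Σ_j weight (k+1) j · cnt (n - j(k+1)) k,
-- i.e. cnt(-, k+1) is cnt(-, k) times the generating factor of the part
-- size k+1.  Modulo 2 the weight of j ≥ 1 copies of a part s is odd exactly
-- when s ≡ 2 (mod 4): so the factor is 1 unless s ≡ 2 (mod 4), in which
-- case it is 1/(1 - qˢ).

weightIsOdd : ℕ → ℕ → Bool
weightIsOdd s zero = true
weightIsOdd s (suc j) = s % 4 ≡ᵇ 2

isOdd-weight : ∀ s j → isOdd (weight s j) ≡ weightIsOdd s j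
isOdd-weight s zero = refl
isOdd-weight s (suc j) with s % 4
... | 0 = refl
... | 1 = refl
... | 2 = refl
... | suc (suc (suc _)) = refl

partTerm : ℕ → Series → ℕ → ℕ → Bool
partTerm s f n j = if j * s ≤ᵇ n then weightIsOdd s j ∧ f (n ∸ j * s) else false

partFactor : ℕ → Series → Series
partFactor s f n = xorAll (map (partTerm s f n) (upTo (suc n)))

cntParity : ℕ → Series
cntParity k n = isOdd (cnt n k)

cntParity-zero : cntParity 0 ≗ unit
cntParity-zero zero = refl
cntParity-zero (suc n) = refl

isOdd-cnt : ∀ k → cntParity (suc k) ≗ partFactor (suc k) (cntParity k)
isOdd-cnt k n = trans (isOdd-sum (map term (upTo (suc n))))
  (cong xorAll (trans (sym (map-∘ {g = isOdd} {f = term} (upTo (suc n)))) (map-cong termParity (upTo (suc n)))))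
  where
  term : ℕ → ℕ
  term j = if (j * suc k) ≤ᵇ n then weight (suc k) j * cnt (n ∸ j * suc k) k else 0
  termParity : ∀ j → isOdd (term j) ≡ partTerm (suc k) (cntParity k) n j
  termParity j rewrite if-float isOdd (j * suc k ≤ᵇ n) {weight (suc k) j * cnt (n ∸ j * suc k) k} {0}
                     | isOdd-* (weight (suc k) j) (cnt (n ∸ j * suc k) k)
                     | isOdd-weight (suc k) j = refl

xorUpTo : (ℕ → Bool) → ℕ → Bool
xorUpTo g n = xorAll (applyUpTo g n)

xorUpTo-cong : ∀ {g h} → (∀ j → g j ≡ h j) → ∀ n → xorUpTo g n ≡ xorUpTo h n
xorUpTo-cong e zero = refl
xorUpTo-cong e (suc n) = cong₂ _xor_ (e 0) (xorUpTo-cong (λ j → e (suc j)) n)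

xorUpTo-false : ∀ {g} → (∀ j → g j ≡ false) → ∀ n → xorUpTo g n ≡ false
xorUpTo-false e zero = refl
xorUpTo-false e (suc n) rewrite e 0 = xorUpTo-false (λ j → e (suc j)) n

xorUpTo-truncate : ∀ {g} b a → (∀ j → b ≤ j → g j ≡ false) → b ≤ a → xorUpTo g a ≡ xorUpTo g b
xorUpTo-truncate zero a e _ = xorUpTo-false (λ j → e j z≤n) a
xorUpTo-truncate {g} (suc b) (suc a) e (s≤s p) =
  cong (g 0 xor_) (xorUpTo-truncate {g ∘ suc} b a (λ j q → e (suc j) (s≤s q)) p)

map-applyUpTo : ∀ (f : ℕ → Bool) (g : ℕ → ℕ) n → map f (applyUpTo g n) ≡ applyUpTo (f ∘ g) n
map-applyUpTo f g zero = refl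
map-applyUpTo f g (suc n) = cong (f (g 0) ∷_) (map-applyUpTo f (g ∘ suc) n)

partFactor-unfold : ∀ s f n → partFactor s f n ≡ f n xor xorUpTo (partTerm s f n ∘ suc) n
partFactor-unfold s f n = cong (f n xor_) (cong xorAll (map-applyUpTo _ suc n))

partFactor-trivial : ∀ s f → (s % 4 ≡ᵇ 2) ≡ false → partFactor s f ≗ f
partFactor-trivial s f s≢2 n = trans (partFactor-unfold s f n)
  (trans (cong (f n xor_) (xorUpTo-false higherTerm n)) (xor-identityʳ (f n)))
  where
  higherTerm : ∀ j → partTerm s f n (suc j) ≡ false
  higherTerm j rewrite s≢2 with suc j * s ≤ᵇ n
  ... | true = refl
  ... | false = refl

partFactor-geometric : ∀ k f → (suc k % 4 ≡ᵇ 2) ≡ true →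
                       ∀ n → partFactor (suc k) f n ≡ f n xor shift (suc k) (partFactor (suc k) f) n
partFactor-geometric k f s≡2 n with suc k ≤? n
... | no s≰n = trans (partFactor-unfold s f n) (cong (f n xor_)
        (trans (xorUpTo-false higherTerm n) (cong (λ b → if b then partFactor s f (n ∸ s) else false) (sym (≤ᵇ-false (≰⇒> s≰n))))))
  where
  s : ℕ
  s = suc k
  higherTerm : ∀ j → partTerm s f n (suc j) ≡ false
  higherTerm j rewrite ≤ᵇ-false {suc j * s} {n} (<-≤-trans (≰⇒> s≰n) (m≤m+n s (j * s))) = refl
... | yes s≤n = subst (λ n → partFactor s f n ≡ f n xor shift s (partFactor s f) n) (m+[n∸m]≡n s≤n) (shifted (n ∸ s))
  where
  s : ℕ
  s = suc k
  shifted : ∀ n' → partFactor s f (s + n') ≡ f (s + n') xor shift s (partFactor s f) (s + n')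
  shifted n' = trans (partFactor-unfold s f (s + n')) (cong (f (s + n') xor_) (trans reindexed truncated))
    where
    -- all weights are odd for this s, so the terms are just the shifted coefficients
    term : ℕ → Bool
    term j = if j * s ≤ᵇ n' then f (n' ∸ j * s) else false
    allOdd : ∀ j → weightIsOdd s j ≡ true
    allOdd zero = refl
    allOdd (suc j) = s≡2
    dropWeight : ∀ j → partTerm s f n' j ≡ term j
    dropWeight j with j * s ≤ᵇ n'
    ... | true rewrite allOdd j = refl
    ... | false = refl
    higherTerm : ∀ j → partTerm s f (s + n') (suc j) ≡ term j
    higherTerm j rewrite +-cancel-≤ᵇ s (j * s) n' | [m+n]∸[m+o]≡n∸o s n' (j * s) | s≡2 = refl
    reindexed : xorUpTo (partTerm s f (s + n') ∘ suc) (s + n') ≡ xorUpTo term (suc n')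
    reindexed = trans (xorUpTo-cong higherTerm (s + n')) (xorUpTo-truncate (suc n') (s + n') vanish (s≤s (m≤n+m n' k)))
      where
      vanish : ∀ j → suc n' ≤ j → term j ≡ false
      vanish j q rewrite ≤ᵇ-false {j * s} {n'} (<-≤-trans q (m≤m*n j s)) = refl
    truncated : xorUpTo term (suc n') ≡ shift s (partFactor s f) (s + n')
    truncated rewrite ≤ᵇ-true (m≤m+n s n') | m+n∸m≡n s n' =
      sym (trans (cong xorAll (map-applyUpTo (partTerm s f n') id (suc n'))) (xorUpTo-cong dropWeight (suc n')))

-- A finite form of Euler's identity "odd parts = distinct parts", mod 2.
-- Write Pₖ for the parity series of cnt(-, k), i.e. the product over part
-- sizes s ≤ k, s ≡ 2 (mod 4), of 1/(1 - qˢ).  We show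
--   Pₖ · ∏_{k < w ≤ 2k, 4 ∣ w} (1 + qʷ)  =  ∏_{t ≤ k, t even} (1 + qᵗ),
-- by induction on k, using 1/(1 - qᵗ) = (1 + qᵗ)/(1 - q²ᵗ) in F₂[[q]].

mulIfDiv4 : ℕ → Series → Series
mulIfDiv4 w g = if w % 4 ≡ᵇ 0 then times1+ w g else g

mulRange : ℕ → ℕ → Series → Series
mulRange a zero f = f
mulRange a (suc l) f = mulRange (suc a) l (mulIfDiv4 a f)

mulIfEven : ℕ → Series → Series
mulIfEven t g = if isOdd t then g else times1+ t g

evenProduct : ℕ → Series
evenProduct zero = unit
evenProduct (suc k) = mulIfEven (suc k) (evenProduct k)

mulIfDiv4-skip : ∀ w {f} → (w % 4 ≡ᵇ 0) ≡ false → mulIfDiv4 w f ≗ f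
mulIfDiv4-skip w e rewrite e = λ n → refl

mulIfDiv4-apply : ∀ w {f} → (w % 4 ≡ᵇ 0) ≡ true → mulIfDiv4 w f ≗ times1+ w f
mulIfDiv4-apply w e rewrite e = λ n → refl

mulIfEven-skip : ∀ t {g} → isOdd t ≡ true → mulIfEven t g ≗ g
mulIfEven-skip t e rewrite e = λ n → refl

mulIfEven-apply : ∀ t {g} → isOdd t ≡ false → mulIfEven t g ≗ times1+ t g
mulIfEven-apply t e rewrite e = λ n → refl

mulIfDiv4-cong : ∀ w {f g} → f ≗ g → mulIfDiv4 w f ≗ mulIfDiv4 w g
mulIfDiv4-cong w e with w % 4 ≡ᵇ 0
... | true = times1+-cong w e
... | false = e

mulIfDiv4-low : ∀ w f n → n < w → mulIfDiv4 w f n ≡ f n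
mulIfDiv4-low w f n p with w % 4 ≡ᵇ 0
... | true = times1+-low w f n p
... | false = refl

record Multiplier (C : Series → Series) : Set where
  field
    cong-≗ : ∀ {f g} → f ≗ g → C f ≗ C g
    comm : ∀ u f → C (times1+ u f) ≗ times1+ u (C f)

mulRange-multiplier : ∀ a l → Multiplier (mulRange a l)
mulRange-multiplier a zero = record { cong-≗ = id ; comm = λ u f → ≗-refl }
mulRange-multiplier a (suc l) = record
  { cong-≗ = λ e → cong-≗ (mulIfDiv4-cong a e)
  ; comm = λ u f → ≗-trans (cong-≗ (mulIfDiv4-comm u f)) (comm u (mulIfDiv4 a f))
  }
  where
  open Multiplier (mulRange-multiplier (suc a) l)
  mulIfDiv4-comm : ∀ u f → mulIfDiv4 a (times1+ u f) ≗ times1+ u (mulIfDiv4 a f)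
  mulIfDiv4-comm u f with a % 4 ≡ᵇ 0
  ... | true = times1+-comm a u f
  ... | false = ≗-refl

mulRange-snoc : ∀ a l f → mulRange a (suc l) f ≗ mulIfDiv4 (a + l) (mulRange a l f)
mulRange-snoc a zero f rewrite +-identityʳ a = ≗-refl
mulRange-snoc a (suc l) f rewrite +-suc a l = mulRange-snoc (suc a) l (mulIfDiv4 a f)

mulRange-low : ∀ a l f n → n < a → mulRange a l f n ≡ f n
mulRange-low a zero f n p = refl
mulRange-low a (suc l) f n p = trans (mulRange-low (suc a) l (mulIfDiv4 a f) n (m<n⇒m<1+n p)) (mulIfDiv4-low a f n p)

record Mod4View (t : ℕ) : Set where
  constructor mod4View
  field
    r : ℕ
    r<4 : r < 4
    mod≡ : t % 4 ≡ r
    isOdd≡ : isOdd t ≡ isOdd r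
    double≡ : (t + t) % 4 ≡ (r + r) % 4

mod4-view : ∀ t → Mod4View t
mod4-view t = mod4View r (m%n<n t 4) refl isOdd-t double-t
  where
  r : ℕ
  r = t % 4
  q : ℕ
  q = t / 4
  t≡ : t ≡ r + q * 4
  t≡ = m≡m%n+[m/n]*n t 4
  isOdd-t : isOdd t ≡ isOdd r
  isOdd-t = begin
    isOdd t                          ≡⟨ cong isOdd t≡ ⟩
    isOdd (r + q * 4)                ≡⟨ isOdd-+ r (q * 4) ⟩
    isOdd r xor isOdd (q * 4)        ≡⟨ cong (isOdd r xor_) (trans (isOdd-* q 4) (∧-zeroʳ (isOdd q))) ⟩
    isOdd r xor false                ≡⟨ xor-identityʳ (isOdd r) ⟩
    isOdd r ∎
    where open ≡-Reasoning
  regroup : ∀ r q → (r + q * 4) + (r + q * 4) ≡ (r + r) + (q + q) * 4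
  regroup = solve-∀
  double-t : (t + t) % 4 ≡ (r + r) % 4
  double-t = trans (cong (λ x → (x + x) % 4) t≡) (trans (cong (_% 4) (regroup r q)) ([m+kn]%n≡m%n (r + r) (q + q) 4))

odd⇒not-div4 : ∀ t → isOdd t ≡ true → (t % 4 ≡ᵇ 0) ≡ false
odd⇒not-div4 t odd with mod4-view t
... | mod4View zero _ _ isOdd≡ _ with () ← trans (sym odd) isOdd≡
... | mod4View (suc zero) _ mod≡ _ _ rewrite mod≡ = refl
... | mod4View (suc (suc zero)) _ mod≡ _ _ rewrite mod≡ = refl
... | mod4View (suc (suc (suc zero))) _ mod≡ _ _ rewrite mod≡ = refl
... | mod4View (suc (suc (suc (suc _)))) (s≤s (s≤s (s≤s (s≤s ())))) _ _ _

-- The induction step, for part size t = k+1 and the product C of the factors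
-- for w ∈ (t, 2t) with 4 ∣ w: passing from t-1 to t removes the factor for
-- w = t, adds the one for w = 2t, and multiplies Pₜ₋₁ by the factor of t.
EulerStep : ℕ → (Series → Series) → Set
EulerStep k C = ∀ X E → C (mulIfDiv4 (suc k) X) ≗ E →
  mulIfDiv4 (suc k + suc k) (C (partFactor (suc k) X)) ≗ mulIfEven (suc k) E

-- t odd: none of the three factors involved is present.
euler-step-odd : ∀ k {C} → Multiplier C → ((suc k + suc k) % 4 ≡ᵇ 0) ≡ false →
  (suc k % 4 ≡ᵇ 2) ≡ false → (suc k % 4 ≡ᵇ 0) ≡ false → isOdd (suc k) ≡ true → EulerStep k C
euler-step-odd k {C} mult double≢0 t≢2 t≢0 odd X E ih = begin
  mulIfDiv4 (t + t) (C (partFactor t X))  ≈⟨ mulIfDiv4-skip (t + t) double≢0 ⟩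
  C (partFactor t X)                      ≈⟨ cong-≗ (partFactor-trivial t X t≢2) ⟩
  C X                                     ≈⟨ cong-≗ (mulIfDiv4-skip t t≢0) ⟨
  C (mulIfDiv4 t X)                       ≈⟨ ih ⟩
  E                                       ≈⟨ mulIfEven-skip t odd ⟨
  mulIfEven t E ∎
  where
  t : ℕ
  t = suc k
  open Multiplier mult
  open ≗-Reasoning

-- 4 ∣ t: (1 + q²ᵗ) = (1 + qᵗ)² moves one factor (1 + qᵗ) outside.
euler-step-0 : ∀ k {C} → Multiplier C → ((suc k + suc k) % 4 ≡ᵇ 0) ≡ true →
  (suc k % 4 ≡ᵇ 2) ≡ false → (suc k % 4 ≡ᵇ 0) ≡ true → isOdd (suc k) ≡ false → EulerStep k C
euler-step-0 k {C} mult double≡0 t≢2 t≡0 even X E ih = begin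
  mulIfDiv4 (t + t) (C (partFactor t X))  ≈⟨ mulIfDiv4-apply (t + t) double≡0 ⟩
  times1+ (t + t) (C (partFactor t X))    ≈⟨ times1+-cong (t + t) (cong-≗ (partFactor-trivial t X t≢2)) ⟩
  times1+ (t + t) (C X)                   ≈⟨ comm (t + t) X ⟨
  C (times1+ (t + t) X)                   ≈⟨ cong-≗ (times1+-square t X) ⟨
  C (times1+ t (times1+ t X))             ≈⟨ comm t (times1+ t X) ⟩
  times1+ t (C (times1+ t X))             ≈⟨ times1+-cong t (cong-≗ (mulIfDiv4-apply t t≡0)) ⟨
  times1+ t (C (mulIfDiv4 t X))           ≈⟨ times1+-cong t ih ⟩
  times1+ t E                             ≈⟨ mulIfEven-apply t even ⟨
  mulIfEven t E ∎
  where
  t : ℕ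
  t = suc k
  open Multiplier mult
  open ≗-Reasoning

-- t ≡ 2 (mod 4): (1 + q²ᵗ)/(1 - qᵗ) = (1 + qᵗ)² / (1 - qᵗ) = (1 + qᵗ).
euler-step-2 : ∀ k {C} → Multiplier C → ((suc k + suc k) % 4 ≡ᵇ 0) ≡ true →
  (suc k % 4 ≡ᵇ 2) ≡ true → (suc k % 4 ≡ᵇ 0) ≡ false → isOdd (suc k) ≡ false → EulerStep k C
euler-step-2 k {C} mult double≡0 t≡2 t≢0 even X E ih = begin
  mulIfDiv4 (t + t) (C Y)                 ≈⟨ mulIfDiv4-apply (t + t) double≡0 ⟩
  times1+ (t + t) (C Y)                   ≈⟨ comm (t + t) Y ⟨
  C (times1+ (t + t) Y)                   ≈⟨ cong-≗ (times1+-square t Y) ⟨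
  C (times1+ t (times1+ t Y))             ≈⟨ cong-≗ (times1+-cong t (times1+-geometric t X Y (partFactor-geometric k X t≡2))) ⟩
  C (times1+ t X)                         ≈⟨ comm t X ⟩
  times1+ t (C X)                         ≈⟨ times1+-cong t (cong-≗ (mulIfDiv4-skip t t≢0)) ⟨
  times1+ t (C (mulIfDiv4 t X))           ≈⟨ times1+-cong t ih ⟩
  times1+ t E                             ≈⟨ mulIfEven-apply t even ⟨
  mulIfEven t E ∎
  where
  t : ℕ
  t = suc k
  Y : Series
  Y = partFactor t X
  open Multiplier mult
  open ≗-Reasoning

euler-step : ∀ k {C} → Multiplier C → EulerStep k C
euler-step k mult with mod4-view (suc k)
... | mod4View 0 _ mod≡ isOdd≡ double≡ =
  euler-step-0 k mult (cong (_≡ᵇ 0) double≡) (cong (_≡ᵇ 2) mod≡) (cong (_≡ᵇ 0) mod≡) isOdd≡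
... | mod4View 1 _ mod≡ isOdd≡ double≡ =
  euler-step-odd k mult (cong (_≡ᵇ 0) double≡) (cong (_≡ᵇ 2) mod≡) (cong (_≡ᵇ 0) mod≡) isOdd≡
... | mod4View 2 _ mod≡ isOdd≡ double≡ =
  euler-step-2 k mult (cong (_≡ᵇ 0) double≡) (cong (_≡ᵇ 2) mod≡) (cong (_≡ᵇ 0) mod≡) isOdd≡
... | mod4View 3 _ mod≡ isOdd≡ double≡ =
  euler-step-odd k mult (cong (_≡ᵇ 0) double≡) (cong (_≡ᵇ 2) mod≡) (cong (_≡ᵇ 0) mod≡) isOdd≡
... | mod4View (suc (suc (suc (suc _)))) (s≤s (s≤s (s≤s (s≤s ())))) _ _ _

euler-partial : ∀ k → mulRange (suc k) k (cntParity k) ≗ evenProduct k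
euler-partial zero = cntParity-zero
euler-partial (suc zero) = ≗-trans (isOdd-cnt 0) (≗-trans (partFactor-trivial 1 (cntParity 0) refl) cntParity-zero)
euler-partial (suc (suc k)) = begin
  mulRange (suc t) (suc (suc k)) Y                         ≈⟨ mulRange-snoc (suc t) (suc k) Y ⟩
  mulIfDiv4 (suc t + suc k) (mulRange (suc t) (suc k) Y)   ≈⟨ mulIfDiv4-cong (suc t + suc k) (mulRange-snoc (suc t) k Y) ⟩
  mulIfDiv4 (suc t + suc k) (mulIfDiv4 (suc t + k) (C Y))  ≈⟨ mulIfDiv4-cong (suc t + suc k) (mulIfDiv4-skip (suc t + k) 2k+3-not-div4) ⟩
  mulIfDiv4 (suc t + suc k) (C Y)                          ≡⟨ cong (λ w → mulIfDiv4 w (C Y)) (sym (+-suc t (suc k))) ⟩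
  mulIfDiv4 (t + t) (C Y)                                  ≈⟨ mulIfDiv4-cong (t + t) (Multiplier.cong-≗ (mulRange-multiplier (suc t) k) (isOdd-cnt (suc k))) ⟩
  mulIfDiv4 (t + t) (C (partFactor t (cntParity (suc k)))) ≈⟨ euler-step (suc k) (mulRange-multiplier (suc t) k) _ _ (euler-partial (suc k)) ⟩
  evenProduct t ∎
  where
  t : ℕ
  t = suc (suc k)
  Y : Series
  Y = cntParity t
  C : Series → Series
  C = mulRange (suc t) k
  2k+3-not-div4 : ((suc t + k) % 4 ≡ᵇ 0) ≡ false
  2k+3-not-div4 = odd⇒not-div4 (suc t + k) (cong (not ∘ not ∘ not) (isOdd-double k))
  open ≗-Reasoning

-- Taking k = n and reading off the coefficient of qⁿ (the extra factors
-- only affect coefficients of degree > n).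
isOdd-Cbar41 : ∀ n → isOdd (Cbar41 n) ≡ evenProduct n n
isOdd-Cbar41 n = trans (sym (mulRange-low (suc n) n (cntParity n) n (n<1+n n))) (euler-partial n n)

-- Substituting q ↦ q²: ∏_{t ≤ 2N, t even} (1 + qᵗ) is the dilation of
-- ∏_{k ≤ N} (1 + qᵏ).

double : ℕ → ℕ
double zero = zero
double (suc n) = suc (suc (double n))

isOdd-doubled : ∀ n → isOdd (double n) ≡ false
isOdd-doubled zero = refl
isOdd-doubled (suc n) rewrite isOdd-doubled n = refl

double≡2* : ∀ n → double n ≡ 2 * n
double≡2* zero = refl
double≡2* (suc n) = trans (cong (suc ∘ suc) (double≡2* n)) (sym (+-suc (suc n) (n + 0)))

even-or-odd : ∀ n → ∃ λ N → (n ≡ double N) ⊎ (n ≡ suc (double N))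
even-or-odd zero = 0 , inj₁ refl
even-or-odd (suc zero) = 0 , inj₂ refl
even-or-odd (suc (suc n)) with even-or-odd n
... | N , inj₁ e = suc N , inj₁ (cong (suc ∘ suc) e)
... | N , inj₂ e = suc N , inj₂ (cong (suc ∘ suc) e)

-- f(q) ↦ f(q²)
dilate : Series → Series
dilate f zero = f 0
dilate f (suc zero) = false
dilate f (suc (suc n)) = dilate (f ∘ suc) n

dilate-cong : ∀ {f g} → f ≗ g → dilate f ≗ dilate g
dilate-cong e zero = e 0
dilate-cong e (suc zero) = refl
dilate-cong e (suc (suc n)) = dilate-cong (λ m → e (suc m)) n

dilate-false : ∀ {f} → (∀ m → f m ≡ false) → ∀ n → dilate f n ≡ false
dilate-false e zero = e 0
dilate-false e (suc zero) = refl
dilate-false e (suc (suc n)) = dilate-false (λ m → e (suc m)) n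

dilate-xor : ∀ f g n → dilate (λ m → f m xor g m) n ≡ dilate f n xor dilate g n
dilate-xor f g zero = refl
dilate-xor f g (suc zero) = refl
dilate-xor f g (suc (suc n)) = dilate-xor (f ∘ suc) (g ∘ suc) n

dilate-double : ∀ f q → dilate f (double q) ≡ f q
dilate-double f zero = refl
dilate-double f (suc q) = dilate-double (f ∘ suc) q

dilate-oddIndex : ∀ f q → dilate f (suc (double q)) ≡ false
dilate-oddIndex f zero = refl
dilate-oddIndex f (suc q) = dilate-oddIndex (f ∘ suc) q

dilate-shift : ∀ t f n → shift (double t) (dilate f) n ≡ dilate (shift t f) n
dilate-shift zero f n = refl
dilate-shift (suc t) f zero = refl
dilate-shift (suc t) f (suc zero) = refl
dilate-shift (suc t) f (suc (suc n)) =
  trans (cong (λ b → if b then dilate f (n ∸ double t) else false) (trans (<ᵇ-suc (suc (double t)) (suc n)) (<ᵇ-suc (double t) n)))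
  (trans (dilate-shift t f n) (dilate-cong shift-suc n))
  where
  shift-suc : ∀ m → shift t f m ≡ shift (suc t) f (suc m)
  shift-suc m = cong (λ b → if b then f (m ∸ t) else false) (sym (<ᵇ-suc t m))

dilate-times1+ : ∀ t f → times1+ (double t) (dilate f) ≗ dilate (times1+ t f)
dilate-times1+ t f n = trans (cong (dilate f n xor_) (dilate-shift t f n)) (sym (dilate-xor f (shift t f) n))

dilate-unit : dilate unit ≗ unit
dilate-unit zero = refl
dilate-unit (suc zero) = refl
dilate-unit (suc (suc n)) = dilate-false (λ m → refl) n

distinctProduct : ℕ → Series
distinctProduct zero = unit
distinctProduct (suc N) = times1+ (suc N) (distinctProduct N)

evenProduct-double : ∀ N → evenProduct (double N) ≗ dilate (distinctProduct N)
evenProduct-double zero = ≗-sym dilate-unit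
evenProduct-double (suc N) = begin
  mulIfEven (suc (suc (double N))) (mulIfEven (suc (double N)) (evenProduct (double N)))
    ≈⟨ mulIfEven-apply (suc (suc (double N))) (cong (not ∘ not) (isOdd-doubled N)) ⟩
  times1+ (double (suc N)) (mulIfEven (suc (double N)) (evenProduct (double N)))
    ≈⟨ times1+-cong (double (suc N)) (mulIfEven-skip (suc (double N)) (cong not (isOdd-doubled N))) ⟩
  times1+ (double (suc N)) (evenProduct (double N))
    ≈⟨ times1+-cong (double (suc N)) (evenProduct-double N) ⟩
  times1+ (double (suc N)) (dilate (distinctProduct N))
    ≈⟨ dilate-times1+ (suc N) (distinctProduct N) ⟩
  dilate (distinctProduct (suc N)) ∎
  where open ≗-Reasoning

isOdd-Cbar41-even : ∀ N → isOdd (Cbar41 (double N)) ≡ distinctProduct N N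
isOdd-Cbar41-even N = trans (isOdd-Cbar41 (double N))
  (trans (evenProduct-double N (double N)) (dilate-double (distinctProduct N) N))

isOdd-Cbar41-odd : ∀ N → isOdd (Cbar41 (suc (double N))) ≡ false
isOdd-Cbar41-odd N = trans (isOdd-Cbar41 (suc (double N)))
  (trans (mulIfEven-skip (suc (double N)) (cong not (isOdd-doubled N)) (suc (double N)))
  (trans (evenProduct-double N (suc (double N))) (dilate-oddIndex (distinctProduct N) N)))

-- Partitions into distinct parts ≤ N are subsets of {1, …, N}, encoded as
-- bit vectors whose head is the membership bit of the largest element N.

sumOver : {X : Set} → (X → ℕ) → List X → ℕ
sumOver f xs = sum (map f xs)

sumOver-++ : ∀ {X : Set} (f : X → ℕ) xs ys → sumOver f (xs ++ ys) ≡ sumOver f xs + sumOver f ys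
sumOver-++ f xs ys = trans (cong sum (map-++ f xs ys)) (sum-++ (map f xs) (map f ys))

sumOver-map : ∀ {X Y : Set} (f : Y → ℕ) (g : X → Y) xs → sumOver f (map g xs) ≡ sumOver (f ∘ g) xs
sumOver-map f g xs = cong sum (sym (map-∘ xs))

sumOver-cong : ∀ {X : Set} {f g : X → ℕ} → (∀ x → f x ≡ g x) → ∀ xs → sumOver f xs ≡ sumOver g xs
sumOver-cong e xs = cong sum (map-cong e xs)

sumOver-zero : ∀ {X : Set} {f : X → ℕ} → (∀ x → f x ≡ 0) → ∀ xs → sumOver f xs ≡ 0
sumOver-zero e [] = refl
sumOver-zero e (x ∷ xs) rewrite e x = sumOver-zero e xs

sumOver-if : ∀ {X : Set} (c : Bool) (f : X → ℕ) xs → sumOver (λ x → if c then f x else 0) xs ≡ (if c then sumOver f xs else 0)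
sumOver-if true f xs = refl
sumOver-if false f xs = sumOver-zero (λ _ → refl) xs

subsets : (N : ℕ) → List (Vec Bool N)
subsets zero = [] ∷ []
subsets (suc N) = map (false ∷_) (subsets N) ++ map (true ∷_) (subsets N)

total : ∀ {N} → Vec Bool N → ℕ
total [] = 0
total {suc N} (b ∷ v) = (if b then suc N else 0) + total v

indicator : Bool → ℕ
indicator b = if b then 1 else 0

countSubsets : ℕ → ℕ → ℕ
countSubsets N m = sumOver (λ v → indicator (total v ≡ᵇ m)) (subsets N)

+≡ᵇ-split : ∀ a w m → (a + w ≡ᵇ m) ≡ (if a ≤ᵇ m then (w ≡ᵇ m ∸ a) else false)
+≡ᵇ-split zero w m = refl
+≡ᵇ-split (suc a) w zero = refl
+≡ᵇ-split (suc a) w (suc m) = trans (+≡ᵇ-split a w m) (cong (λ b → if b then (w ≡ᵇ m ∸ a) else false) (sym (<ᵇ-suc a m)))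

countSubsets-suc : ∀ N m → countSubsets (suc N) m ≡
  countSubsets N m + (if suc N ≤ᵇ m then countSubsets N (m ∸ suc N) else 0)
countSubsets-suc N m = begin
  countSubsets (suc N) m
    ≡⟨ sumOver-++ hasSum (map (false ∷_) (subsets N)) (map (true ∷_) (subsets N)) ⟩
  sumOver hasSum (map (false ∷_) (subsets N)) + sumOver hasSum (map (true ∷_) (subsets N))
    ≡⟨ cong₂ _+_ (sumOver-map hasSum (false ∷_) (subsets N)) (sumOver-map hasSum (true ∷_) (subsets N)) ⟩
  countSubsets N m + sumOver (hasSum ∘ (true ∷_)) (subsets N)
    ≡⟨ cong (countSubsets N m +_) (sumOver-cong withTop (subsets N)) ⟩
  countSubsets N m + sumOver (λ v → if suc N ≤ᵇ m then indicator (total v ≡ᵇ m ∸ suc N) else 0) (subsets N)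
    ≡⟨ cong (countSubsets N m +_) (sumOver-if (suc N ≤ᵇ m) (λ v → indicator (total v ≡ᵇ m ∸ suc N)) (subsets N)) ⟩
  countSubsets N m + (if suc N ≤ᵇ m then countSubsets N (m ∸ suc N) else 0) ∎
  where
  open ≡-Reasoning
  hasSum : Vec Bool (suc N) → ℕ
  hasSum v = indicator (total v ≡ᵇ m)
  withTop : ∀ v → hasSum (true ∷ v) ≡ (if suc N ≤ᵇ m then indicator (total v ≡ᵇ m ∸ suc N) else 0)
  withTop v = trans (cong indicator (+≡ᵇ-split (suc N) (total v) m)) (if-float indicator (suc N ≤ᵇ m))

distinctProduct-count : ∀ N m → distinctProduct N m ≡ isOdd (countSubsets N m)
distinctProduct-count zero zero = refl
distinctProduct-count zero (suc m) = refl
distinctProduct-count (suc N) m = begin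
  distinctProduct N m xor shift (suc N) (distinctProduct N) m
    ≡⟨ cong₂ _xor_ (distinctProduct-count N m) shifted ⟩
  isOdd (countSubsets N m) xor isOdd withTop
    ≡⟨ isOdd-+ (countSubsets N m) withTop ⟨
  isOdd (countSubsets N m + withTop)
    ≡⟨ cong isOdd (countSubsets-suc N m) ⟨
  isOdd (countSubsets (suc N) m) ∎
  where
  open ≡-Reasoning
  withTop : ℕ
  withTop = if suc N ≤ᵇ m then countSubsets N (m ∸ suc N) else 0
  shifted : shift (suc N) (distinctProduct N) m ≡ isOdd withTop
  shifted with suc N ≤ᵇ m
  ... | true = distinctProduct-count N (m ∸ suc N)
  ... | false = refl

-- Subsets as membership predicates.  member v i says whether i ∈ v (for
-- 1 ≤ i ≤ N; it is false elsewhere), toggleAt v p adds or removes p.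
-- Franklin's moves are each a composition of three toggles.

member : ∀ {N} → Vec Bool N → ℕ → Bool
member [] i = false
member {suc N} (b ∷ v) i = if i ≡ᵇ suc N then b else member v i

toggle : ℕ → Series → Series
toggle p h i = if i ≡ᵇ p then not (h i) else h i

toggleAt : ∀ {N} → Vec Bool N → ℕ → Vec Bool N
toggleAt [] p = []
toggleAt {suc N} (b ∷ v) p = if p ≡ᵇ suc N then not b ∷ v else b ∷ toggleAt v p

member-top : ∀ {N} b (v : Vec Bool N) → member (b ∷ v) (suc N) ≡ b
member-top {N} b v rewrite ≡ᵇ-refl N = refl

member-low : ∀ {N} b (v : Vec Bool N) i → i ≢ suc N → member (b ∷ v) i ≡ member v i
member-low b v i i≢N+1 rewrite ≢⇒≡ᵇ-false i≢N+1 = refl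

member-beyond : ∀ {N} (v : Vec Bool N) i → N < i → member v i ≡ false
member-beyond [] i N<i = refl
member-beyond {suc N} (b ∷ v) i N<i = trans (member-low b v i (λ e → <-irrefl (sym e) N<i)) (member-beyond v i (<-trans (n<1+n N) N<i))

member-zero : ∀ {N} (v : Vec Bool N) → member v 0 ≡ false
member-zero [] = refl
member-zero (b ∷ v) = member-zero v

toggle-same : ∀ p h → toggle p h p ≡ not (h p)
toggle-same p h rewrite ≡ᵇ-refl p = refl

toggle-other : ∀ p h i → i ≢ p → toggle p h i ≡ h i
toggle-other p h i i≢p rewrite ≢⇒≡ᵇ-false i≢p = refl

toggle-involutive : ∀ p h i → toggle p (toggle p h) i ≡ h i
toggle-involutive p h i with i ≡ᵇ p
... | true = not-involutive (h i)
... | false = refl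

toggle-cong : ∀ p {h h'} → h ≗ h' → toggle p h ≗ toggle p h'
toggle-cong p e i rewrite e i = refl

member-toggleAt : ∀ {N} (v : Vec Bool N) p i → 1 ≤ p → p ≤ N → member (toggleAt v p) i ≡ toggle p (member v) i
member-toggleAt [] zero i () p≤N
member-toggleAt [] (suc p) i p≥1 ()
member-toggleAt {suc N} (b ∷ v) p i p≥1 p≤N with p ≟ suc N
... | yes refl rewrite ≡ᵇ-refl N with i ≟ suc N
...   | yes refl = trans (member-top (not b) v) (sym (trans (toggle-same (suc N) (member (b ∷ v))) (cong not (member-top b v))))
...   | no i≢N+1 = trans (member-low (not b) v i i≢N+1) (sym (trans (toggle-other (suc N) (member (b ∷ v)) i i≢N+1) (member-low b v i i≢N+1)))
member-toggleAt {suc N} (b ∷ v) p i p≥1 p≤N | no p≢N+1 rewrite ≢⇒≡ᵇ-false p≢N+1 with i ≟ suc N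
...   | yes refl = trans (member-top b (toggleAt v p)) (sym (trans (toggle-other p (member (b ∷ v)) (suc N) (λ e → p≢N+1 (sym e))) (member-top b v)))
...   | no i≢N+1 = trans (member-low b (toggleAt v p) i i≢N+1) (trans (member-toggleAt v p i p≥1 (≤-pred (≤∧≢⇒< p≤N p≢N+1)))
          (sym (toggle-low i i≢N+1)))
  where
  toggle-low : ∀ i → i ≢ suc N → toggle p (member (b ∷ v)) i ≡ toggle p (member v) i
  toggle-low i i≢N+1 rewrite member-low b v i i≢N+1 = refl

member-ext : ∀ {N} (v w : Vec Bool N) → (∀ i → member v i ≡ member w i) → v ≡ w
member-ext [] [] e = refl
member-ext {suc N} (b ∷ v) (c ∷ w) e = cong₂ _∷_ heads (member-ext v w tails)
  where
  heads : b ≡ c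
  heads = trans (sym (member-top b v)) (trans (e (suc N)) (member-top c w))
  tails : ∀ i → member v i ≡ member w i
  tails i with i ≟ suc N
  ... | yes refl = trans (member-beyond v (suc N) (n<1+n N)) (sym (member-beyond w (suc N) (n<1+n N)))
  ... | no i≢N+1 = trans (sym (member-low b v i i≢N+1)) (trans (e i) (member-low c w i i≢N+1))

toggleAt-top : ∀ {N} b (v : Vec Bool N) → toggleAt (b ∷ v) (suc N) ≡ not b ∷ v
toggleAt-top {N} b v rewrite ≡ᵇ-refl N = refl

toggleAt-low : ∀ {N} b (v : Vec Bool N) p → p ≢ suc N → toggleAt (b ∷ v) p ≡ b ∷ toggleAt v p
toggleAt-low b v p p≢N+1 rewrite ≢⇒≡ᵇ-false p≢N+1 = refl

total-remove : ∀ {N} (v : Vec Bool N) p → 1 ≤ p → p ≤ N → member v p ≡ true → total (toggleAt v p) + p ≡ total v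
total-remove [] zero () p≤N p∈v
total-remove [] (suc p) p≥1 () p∈v
total-remove {suc N} (b ∷ v) p p≥1 p≤N p∈v with p ≟ suc N
... | yes refl with trans (sym (member-top b v)) p∈v
...   | refl rewrite toggleAt-top true v = +-comm (total v) (suc N)
total-remove {suc N} (b ∷ v) p p≥1 p≤N p∈v | no p≢N+1 rewrite toggleAt-low b v p p≢N+1 =
  trans (+-assoc (if b then suc N else 0) (total (toggleAt v p)) p)
  (cong ((if b then suc N else 0) +_) (total-remove v p p≥1 (≤-pred (≤∧≢⇒< p≤N p≢N+1)) (trans (sym (member-low b v p p≢N+1)) p∈v)))

total-insert : ∀ {N} (v : Vec Bool N) p → 1 ≤ p → p ≤ N → member v p ≡ false → total (toggleAt v p) ≡ total v + p
total-insert [] zero () p≤N p∉v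
total-insert [] (suc p) p≥1 () p∉v
total-insert {suc N} (b ∷ v) p p≥1 p≤N p∉v with p ≟ suc N
... | yes refl with trans (sym (member-top b v)) p∉v
...   | refl rewrite toggleAt-top false v = +-comm (suc N) (total v)
total-insert {suc N} (b ∷ v) p p≥1 p≤N p∉v | no p≢N+1 rewrite toggleAt-low b v p p≢N+1 =
  trans (cong ((if b then suc N else 0) +_) (total-insert v p p≥1 (≤-pred (≤∧≢⇒< p≤N p≢N+1)) (trans (sym (member-low b v p p≢N+1)) p∉v)))
  (sym (+-assoc (if b then suc N else 0) (total v) p))

total-empty : ∀ {N} (v : Vec Bool N) → (∀ i → member v i ≡ false) → total v ≡ 0
total-empty [] e = refl
total-empty {suc N} (b ∷ v) e with trans (sym (member-top b v)) (e (suc N))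
... | refl = total-empty v (λ i → tails i)
  where
  tails : ∀ i → member v i ≡ false
  tails i with i ≟ suc N
  ... | yes refl = member-beyond v (suc N) (n<1+n N)
  ... | no i≢N+1 = trans (sym (member-low false v i i≢N+1)) (e i)

total-≥-member : ∀ {N} (v : Vec Bool N) p → 1 ≤ p → p ≤ N → member v p ≡ true → p ≤ total v
total-≥-member v p p≥1 p≤N p∈v = subst (p ≤_) (total-remove v p p≥1 p≤N p∈v) (m≤n+m p (total (toggleAt v p)))

total-two-members : ∀ {N} (v : Vec Bool N) p q → 1 ≤ p → p ≤ N → q ≤ N → p < q → member v p ≡ true → member v q ≡ true → p + q ≤ total v
total-two-members v p q p≥1 p≤N q≤N p<q p∈v q∈v =
  subst (p + q ≤_) (trans (+-comm p (total (toggleAt v p))) (total-remove v p p≥1 p≤N p∈v))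
        (+-monoʳ-≤ p (total-≥-member (toggleAt v p) q (≤-trans p≥1 (<⇒≤ p<q)) q≤N (trans (member-toggleAt v p q p≥1 p≤N) (trans (toggle-other p (member v) q (>⇒≢ p<q)) q∈v))))

toggle3 : ℕ → ℕ → ℕ → Series → Series
toggle3 a b c h = toggle c (toggle b (toggle a h))

toggle3-first : ∀ a b c h → a ≢ b → a ≢ c → toggle3 a b c h a ≡ not (h a)
toggle3-first a b c h a≢b a≢c = trans (toggle-other c (toggle b (toggle a h)) a a≢c) (trans (toggle-other b (toggle a h) a a≢b) (toggle-same a h))

toggle3-second : ∀ a b c h → b ≢ a → b ≢ c → toggle3 a b c h b ≡ not (h b)
toggle3-second a b c h b≢a b≢c = trans (toggle-other c (toggle b (toggle a h)) b b≢c) (trans (toggle-same b (toggle a h)) (cong not (toggle-other a h b b≢a)))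

toggle3-third : ∀ a b c h → c ≢ a → c ≢ b → toggle3 a b c h c ≡ not (h c)
toggle3-third a b c h c≢a c≢b = trans (toggle-same c (toggle b (toggle a h))) (cong not (trans (toggle-other b (toggle a h) c c≢b) (toggle-other a h c c≢a)))

toggle3-other : ∀ a b c h i → i ≢ a → i ≢ b → i ≢ c → toggle3 a b c h i ≡ h i
toggle3-other a b c h i i≢a i≢b i≢c = trans (toggle-other c (toggle b (toggle a h)) i i≢c) (trans (toggle-other b (toggle a h) i i≢b) (toggle-other a h i i≢a))

toggle3-cong : ∀ a b c {h h'} → h ≗ h' → toggle3 a b c h ≗ toggle3 a b c h'
toggle3-cong a b c e = toggle-cong c (toggle-cong b (toggle-cong a e))

toggle3-reverse : ∀ a b c h i → toggle3 c b a (toggle3 a b c h) i ≡ h i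
toggle3-reverse a b c h i =
  trans (toggle-cong a (toggle-cong b (toggle-involutive c (toggle b (toggle a h)))) i)
  (trans (toggle-cong a (toggle-involutive b (toggle a h)) i) (toggle-involutive a h i))

member-toggle3 : ∀ {N} (v : Vec Bool N) a b c → 1 ≤ a → a ≤ N → 1 ≤ b → b ≤ N → 1 ≤ c → c ≤ N →
          ∀ i → member (toggleAt (toggleAt (toggleAt v a) b) c) i ≡ toggle3 a b c (member v) i
member-toggle3 v a b c a≥1 a≤N b≥1 b≤N c≥1 c≤N i =
  trans (member-toggleAt (toggleAt (toggleAt v a) b) c i c≥1 c≤N)
  (toggle-cong c (λ j → trans (member-toggleAt (toggleAt v a) b j b≥1 b≤N) (toggle-cong b (λ k → member-toggleAt v a k a≥1 a≤N) j)) i)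

total-moveA : ∀ {N} (v : Vec Bool N) a b c → 1 ≤ a → a ≤ N → 1 ≤ b → b ≤ N → 1 ≤ c → c ≤ N →
       b ≢ a → c ≢ a → c ≢ b → member v a ≡ true → member v b ≡ true → member v c ≡ false → a + b ≡ c →
       total (toggleAt (toggleAt (toggleAt v a) b) c) ≡ total v
total-moveA {N} v a b c a≥1 a≤N b≥1 b≤N c≥1 c≤N b≢a c≢a c≢b a∈v b∈v c∉v a+b≡c =
  begin
    total w3 ≡⟨ total-insert w2 c c≥1 c≤N c∉w2 ⟩
    total w2 + c ≡⟨ cong (total w2 +_) (trans (sym a+b≡c) (+-comm a b)) ⟩
    total w2 + (b + a) ≡⟨ sym (+-assoc (total w2) b a) ⟩
    total w2 + b + a ≡⟨ cong (_+ a) (total-remove w1 b b≥1 b≤N b∈w1) ⟩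
    total w1 + a ≡⟨ total-remove v a a≥1 a≤N a∈v ⟩
    total v ∎
  where
  open ≡-Reasoning
  w1 : Vec Bool N
  w1 = toggleAt v a
  w2 : Vec Bool N
  w2 = toggleAt w1 b
  w3 : Vec Bool N
  w3 = toggleAt w2 c
  b∈w1 : member w1 b ≡ true
  b∈w1 = trans (member-toggleAt v a b a≥1 a≤N) (trans (toggle-other a (member v) b b≢a) b∈v)
  c∉w2 : member w2 c ≡ false
  c∉w2 = trans (member-toggleAt w1 b c b≥1 b≤N) (trans (toggle-other b (member w1) c c≢b)
        (trans (member-toggleAt v a c a≥1 a≤N) (trans (toggle-other a (member v) c c≢a) c∉v)))

total-moveB : ∀ {N} (v : Vec Bool N) a b c → 1 ≤ a → a ≤ N → 1 ≤ b → b ≤ N → 1 ≤ c → c ≤ N →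
       b ≢ a → c ≢ a → c ≢ b → member v a ≡ true → member v b ≡ false → member v c ≡ false → b + c ≡ a →
       total (toggleAt (toggleAt (toggleAt v a) b) c) ≡ total v
total-moveB {N} v a b c a≥1 a≤N b≥1 b≤N c≥1 c≤N b≢a c≢a c≢b a∈v b∉v c∉v b+c≡a =
  begin
    total w3 ≡⟨ total-insert w2 c c≥1 c≤N c∉w2 ⟩
    total w2 + c ≡⟨ cong (_+ c) (total-insert w1 b b≥1 b≤N b∉w1) ⟩
    total w1 + b + c ≡⟨ +-assoc (total w1) b c ⟩
    total w1 + (b + c) ≡⟨ cong (total w1 +_) b+c≡a ⟩
    total w1 + a ≡⟨ total-remove v a a≥1 a≤N a∈v ⟩
    total v ∎
  where
  open ≡-Reasoning
  w1 : Vec Bool N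
  w1 = toggleAt v a
  w2 : Vec Bool N
  w2 = toggleAt w1 b
  w3 : Vec Bool N
  w3 = toggleAt w2 c
  b∉w1 : member w1 b ≡ false
  b∉w1 = trans (member-toggleAt v a b a≥1 a≤N) (trans (toggle-other a (member v) b b≢a) b∉v)
  c∉w2 : member w2 c ≡ false
  c∉w2 = trans (member-toggleAt w1 b c b≥1 b≤N) (trans (toggle-other b (member w1) c c≢b)
        (trans (member-toggleAt v a c a≥1 a≤N) (trans (toggle-other a (member v) c c≢a) c∉v)))

-- The shape data of a nonempty subset S ⊆ {1, …, N} used by Franklin's
-- involution (in terms of the partition S into distinct parts):
--   L = max S (the largest part), s = min S (the smallest part), and
--   σ = the length of the maximal run L, L-1, …, L-σ+1 of elements of S
--       (the "slope" of the partition).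

largest : Series → ℕ → ℕ
largest g zero = zero
largest g (suc n) = if g (suc n) then suc n else largest g n

largest-unique : ∀ g n L → g L ≡ true → L ≤ n → (∀ i → L < i → i ≤ n → g i ≡ false) → largest g n ≡ L
largest-unique g zero .zero L∈ z≤n above∉ = refl
largest-unique g (suc n) L L∈ L≤n above∉ with L ≟ suc n
... | yes refl rewrite L∈ = refl
... | no L≢n+1 rewrite above∉ (suc n) (≤∧≢⇒< L≤n L≢n+1) ≤-refl =
  largest-unique g n L L∈ (≤-pred (≤∧≢⇒< L≤n L≢n+1)) (λ i p q → above∉ i p (m≤n⇒m≤1+n q))

largest-zero : ∀ g n → largest g n ≡ 0 → ∀ i → 1 ≤ i → i ≤ n → g i ≡ false
largest-zero g zero e i p q with ≤-trans p q
... | ()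
largest-zero g (suc n) e i p q with g (suc n) in eq
... | true with e
...   | ()
largest-zero g (suc n) e i p q | false with i ≟ suc n
...   | yes refl = eq
...   | no ne = largest-zero g n e i p (≤-pred (≤∧≢⇒< q ne))

largest-spec : ∀ g n → 1 ≤ largest g n → (g (largest g n) ≡ true) × (largest g n ≤ n) × (∀ i → largest g n < i → i ≤ n → g i ≡ false)
largest-spec g zero ()
largest-spec g (suc n) p with g (suc n) in eq
... | true = eq , ≤-refl , (λ i a b → ⊥-elim (<-irrefl refl (<-≤-trans a b)))
... | false with largest-spec g n p
...   | a , b , c = a , m≤n⇒m≤1+n b , above∉
  where
  above∉ : ∀ i → largest g n < i → i ≤ suc n → g i ≡ false
  above∉ i x y with i ≟ suc n
  ... | yes refl = eq
  ... | no ne = c i x (≤-pred (≤∧≢⇒< y ne))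

-- 0 when there is no element in {1, …, n}.
smallest : Series → ℕ → ℕ
smallest g zero = zero
smallest g (suc n) = if smallest g n ≡ᵇ 0 then (if g (suc n) then suc n else 0) else smallest g n

smallest-empty : ∀ g n → (∀ i → 1 ≤ i → i ≤ n → g i ≡ false) → smallest g n ≡ 0
smallest-empty g zero h = refl
smallest-empty g (suc n) h rewrite smallest-empty g n (λ i p q → h i p (m≤n⇒m≤1+n q)) | h (suc n) (s≤s z≤n) ≤-refl = refl

smallest-unique : ∀ g n s → g s ≡ true → 1 ≤ s → s ≤ n → (∀ i → 1 ≤ i → i < s → g i ≡ false) → smallest g n ≡ s
smallest-unique g zero .zero s∈ () z≤n below∉
smallest-unique g (suc n) s s∈ s≥1 s≤n below∉ with s ≟ suc n
... | yes refl rewrite smallest-empty g n (λ i p q → below∉ i p (s≤s q)) | s∈ = refl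
... | no s≢n+1 rewrite smallest-unique g n s s∈ s≥1 (≤-pred (≤∧≢⇒< s≤n s≢n+1)) below∉ with s
...   | suc s' = refl

smallest-zero : ∀ g n → smallest g n ≡ 0 → ∀ i → 1 ≤ i → i ≤ n → g i ≡ false
smallest-zero g zero e i p q with ≤-trans p q
... | ()
smallest-zero g (suc n) e i p q with smallest g n in eq1
... | suc k with e
...   | ()
smallest-zero g (suc n) e i p q | zero with g (suc n) in eq2
...   | true with e
...     | ()
smallest-zero g (suc n) e i p q | zero | false with i ≟ suc n
...     | yes refl = eq2
...     | no ne = smallest-zero g n eq1 i p (≤-pred (≤∧≢⇒< q ne))

smallest-spec : ∀ g n → 1 ≤ smallest g n → (g (smallest g n) ≡ true) × (smallest g n ≤ n) × (∀ i → 1 ≤ i → i < smallest g n → g i ≡ false)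
smallest-spec g zero ()
smallest-spec g (suc n) p with smallest g n in eq1
... | suc k with smallest-spec g n (subst (1 ≤_) (sym eq1) (s≤s z≤n))
...   | a , b , c rewrite eq1 = a , m≤n⇒m≤1+n b , c
smallest-spec g (suc n) p | zero with g (suc n) in eq2
...   | true = eq2 , ≤-refl , (λ i x y → smallest-zero g n eq1 i x (≤-pred y))
...   | false with p
...     | ()

smallest-positive : ∀ g n p → g p ≡ true → 1 ≤ p → p ≤ n → 1 ≤ smallest g n
smallest-positive g n p gp p≥1 p≤n with smallest g n in e
... | zero = ⊥-elim (true≢false (trans (sym gp) (smallest-zero g n e p p≥1 p≤n)))
... | suc k = s≤s z≤n

topRun : Series → ℕ → ℕ
topRun g zero = zero
topRun g (suc L) = if g (suc L) then suc (topRun g L) else zero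

topRun-≤ : ∀ g L → topRun g L ≤ L
topRun-≤ g zero = z≤n
topRun-≤ g (suc L) with g (suc L)
... | true = s≤s (topRun-≤ g L)
... | false = z≤n

topRun-members : ∀ g L j → L ∸ topRun g L < j → j ≤ L → g j ≡ true
topRun-members g zero j p q = ⊥-elim (<-irrefl refl (<-≤-trans p q))
topRun-members g (suc L) j p q with g (suc L) in eq
... | false = ⊥-elim (<-irrefl refl (<-≤-trans p q))
... | true with j ≟ suc L
...   | yes refl = eq
...   | no ne = topRun-members g L j p (≤-pred (≤∧≢⇒< q ne))

topRun-gap : ∀ (g : Series) (L : ℕ) → g 0 ≡ false → g (L ∸ topRun g L) ≡ false
topRun-gap g zero zero∉ = zero∉
topRun-gap g (suc L) zero∉ with g (suc L) in eq
... | false = eq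
... | true = topRun-gap g L zero∉

topRun-unique : ∀ g L r → r ≤ L → (∀ j → L ∸ r < j → j ≤ L → g j ≡ true) → g (L ∸ r) ≡ false → topRun g L ≡ r
topRun-unique g zero zero _ _ _ = refl
topRun-unique g (suc L) zero _ _ gap∉ rewrite gap∉ = refl
topRun-unique g (suc L) (suc r) (s≤s rL) run∈ gap∉ rewrite run∈ (suc L) (s≤s (m∸n≤m L r)) ≤-refl =
  cong suc (topRun-unique g L r rL (λ j p q → run∈ j p (m≤n⇒m≤1+n q)) gap∉)

topRun-≥ : ∀ g L r → r ≤ L → (∀ j → L ∸ r < j → j ≤ L → g j ≡ true) → r ≤ topRun g L
topRun-≥ g L zero _ _ = z≤n
topRun-≥ g (suc L) (suc r) (s≤s rL) run∈ rewrite run∈ (suc L) (s≤s (m∸n≤m L r)) ≤-refl =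
  s≤s (topRun-≥ g L r rL (λ j p q → run∈ j p (m≤n⇒m≤1+n q)))

-- The two shapes on which Franklin's involution has no move: the parts
-- s = L-σ+1, …, L form one run and s = σ (resp. s = σ + 1).  These are the
-- pentagonal shapes.
Pentagonal₁ : ℕ → ℕ → ℕ → Set
Pentagonal₁ L s σ = (s ≡ suc (L ∸ σ)) × (s ≡ σ)

Pentagonal₂ : ℕ → ℕ → ℕ → Set
Pentagonal₂ L s σ = (s ≡ suc (L ∸ σ)) × (s ≡ suc σ)

pentagonal₁? : ∀ L s σ → Dec (Pentagonal₁ L s σ)
pentagonal₁? L s σ = (s ≟ suc (L ∸ σ)) ×-dec (s ≟ σ)

pentagonal₂? : ∀ L s σ → Dec (Pentagonal₂ L s σ)
pentagonal₂? L s σ = (s ≟ suc (L ∸ σ)) ×-dec (s ≟ suc σ)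

record Shape (g : Series) (N L s σ : ℕ) : Set where
  field
    zero∉ : g 0 ≡ false
    L≥1 : 1 ≤ L
    L≤N : L ≤ N
    L∈ : g L ≡ true
    above-L∉ : ∀ i → L < i → g i ≡ false
    s≥1 : 1 ≤ s
    s∈ : g s ≡ true
    below-s∉ : ∀ i → i < s → g i ≡ false
    σ≥1 : 1 ≤ σ
    σ≤L : σ ≤ L
    run∈ : ∀ j → L ∸ σ < j → j ≤ L → g j ≡ true
    gap∉ : g (L ∸ σ) ≡ false

module ShapeFacts {g N L s σ} (sp : Shape g N L s σ) where
  open Shape sp
  member⇒≥s : ∀ p → g p ≡ true → s ≤ p
  member⇒≥s p e with s ≤? p
  ... | yes q = q
  ... | no nq = ⊥-elim (true≢false (trans (sym e) (below-s∉ p (≰⇒> nq))))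
  member⇒≤L : ∀ p → g p ≡ true → p ≤ L
  member⇒≤L p e with p ≤? L
  ... | yes q = q
  ... | no nq = ⊥-elim (true≢false (trans (sym e) (above-L∉ p (≰⇒> nq))))
  s≤L : s ≤ L
  s≤L = member⇒≤L s s∈
  gap<L : L ∸ σ < L
  gap<L = ∸-monoʳ-< {L} {σ} {0} σ≥1 σ≤L
  s≤gap+1 : s ≤ suc (L ∸ σ)
  s≤gap+1 = member⇒≥s (suc (L ∸ σ)) (run∈ (suc (L ∸ σ)) ≤-refl gap<L)

shape-unique : ∀ {g N L s σ} → Shape g N L s σ → (largest g N ≡ L) × (smallest g N ≡ s) × (topRun g L ≡ σ)
shape-unique {g} {N} {L} {s} {σ} sp =
  largest-unique g N L L∈ L≤N (λ i p q → above-L∉ i p) ,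
  smallest-unique g N s s∈ s≥1 (≤-trans s≤L L≤N) (λ i _ q → below-s∉ i q) ,
  topRun-unique g L σ σ≤L run∈ gap∉
  where
  open Shape sp
  open ShapeFacts sp

-- Let S have shape (L, s, σ).
--   Move A (s ≤ σ): remove the smallest part s and add 1 to each of the s
--     largest parts, i.e. toggle s, L-s+1 and L+1.
--   Move B (s > σ): subtract 1 from each part of the top run and add a new
--     smallest part σ, i.e. toggle L, L-σ and σ.
-- A move is made unless S is pentagonal (or move A would leave {1, …, N});
-- move A produces a shape where move B applies and undoes it, and vice versa.

-- Move A has room: when s ≤ σ and S is not pentagonal, the s largest parts
-- lie strictly above s, i.e. s + s ≤ L.
moveA-room : ∀ {g N L s σ} → Shape g N L s σ → s ≤ σ → ¬ Pentagonal₁ L s σ → s + s ≤ L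
moveA-room {L = L} {s} {σ} sp s≤σ ¬pent with s ≤? L ∸ σ
... | yes s≤gap = subst (s + s ≤_) gap+σ≡L (+-mono-≤ s≤gap s≤σ)
  where
  open Shape sp
  gap+σ≡L : (L ∸ σ) + σ ≡ L
  gap+σ≡L = m∸n+n≡m σ≤L
... | no s≰gap = subst (s + s ≤_) gap+σ≡L (subst (_≤ (L ∸ σ) + σ) (sym s+s≡) (+-monoʳ-≤ (L ∸ σ) s<σ))
  where
  open Shape sp
  open ShapeFacts sp
  gap+σ≡L : (L ∸ σ) + σ ≡ L
  gap+σ≡L = m∸n+n≡m σ≤L
  s≡gap+1 : s ≡ suc (L ∸ σ)
  s≡gap+1 = ≤-antisym s≤gap+1 (≰⇒> s≰gap)
  s<σ : s < σ
  s<σ = ≤∧≢⇒< s≤σ (λ s≡σ → ¬pent (s≡gap+1 , s≡σ))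
  s+s≡ : s + s ≡ (L ∸ σ) + suc s
  s+s≡ = trans (cong (_+ s) s≡gap+1) (sym (+-suc (L ∸ σ) s))

-- After move A (applied to g with shape (L, s, σ), L < N, giving G), G has
-- shape (L+1, s′, s) for some s′ > s, it is not pentagonal, and so move B
-- applies to it.
module MoveA {g N L s σ} (sp : Shape g N L s σ) (s≤σ : s ≤ σ) (¬pent : ¬ Pentagonal₁ L s σ) (L<N : suc L ≤ N)
          (G : Series) (eG : ∀ i → G i ≡ toggle3 s (suc (L ∸ s)) (suc L) g i) where
  open Shape sp
  open ShapeFacts sp
  runLow : ℕ
  runLow = suc (L ∸ s)
  s≤L∸s : s ≤ L ∸ s
  s≤L∸s = m+n≤o⇒m≤o∸n s (moveA-room sp s≤σ ¬pent)
  s<runLow : s < runLow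
  s<runLow = s≤s s≤L∸s
  runLow≤L : runLow ≤ L
  runLow≤L = ∸-monoʳ-< {L} {s} {0} s≥1 s≤L
  gap<runLow : L ∸ σ < runLow
  gap<runLow = s≤s (∸-monoʳ-≤ L s≤σ)
  runLow≡ : suc L ∸ s ≡ runLow
  runLow≡ = +-∸-assoc 1 s≤L
  s<L+1 : s < suc L
  s<L+1 = s≤s s≤L
  runLow<L+1 : runLow < suc L
  runLow<L+1 = s≤s runLow≤L
  s∉G : G s ≡ false
  s∉G = trans (eG s) (trans (toggle3-first s runLow (suc L) g (<⇒≢ s<runLow) (<⇒≢ s<L+1)) (cong not s∈))
  runLow∉G : G runLow ≡ false
  runLow∉G = trans (eG runLow) (trans (toggle3-second s runLow (suc L) g (>⇒≢ s<runLow) (<⇒≢ runLow<L+1)) (cong not (run∈ runLow gap<runLow runLow≤L)))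
  L+1∈G : G (suc L) ≡ true
  L+1∈G = trans (eG (suc L)) (trans (toggle3-third s runLow (suc L) g (>⇒≢ s<L+1) (>⇒≢ runLow<L+1)) (cong not (above-L∉ (suc L) ≤-refl)))
  G-other : ∀ i → i ≢ s → i ≢ runLow → i ≢ suc L → G i ≡ g i
  G-other i i≢s i≢runLow i≢L+1 = trans (eG i) (toggle3-other s runLow (suc L) g i i≢s i≢runLow i≢L+1)
  s′ : ℕ
  s′ = smallest G N
  s′≥1 : 1 ≤ s′
  s′≥1 = smallest-positive G N (suc L) L+1∈G (s≤s z≤n) L<N
  s′-spec : (G s′ ≡ true) × (s′ ≤ N) × (∀ i → 1 ≤ i → i < s′ → G i ≡ false)
  s′-spec = smallest-spec G N s′≥1
  zero∉G : G 0 ≡ false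
  zero∉G = trans (G-other 0 (<⇒≢ s≥1) (λ ()) (λ ())) zero∉
  s<s′ : s < s′
  s<s′ with s′ ≤? s
  ... | no n = ≰⇒> n
  ... | yes q with s′ ≟ s
  ...   | yes e = ⊥-elim (true≢false (trans (sym (proj₁ s′-spec)) (trans (cong G e) s∉G)))
  ...   | no ne = ⊥-elim (true≢false (trans (sym (proj₁ s′-spec)) (trans (G-other s′ ne (<⇒≢ (<-trans s′<s s<runLow)) (<⇒≢ (<-trans s′<s s<L+1))) (below-s∉ s′ s′<s))))
    where
    s′<s : s′ < s
    s′<s = ≤∧≢⇒< q ne
  shape′ : Shape G N (suc L) s′ s
  shape′ = record
    { zero∉ = zero∉G
    ; L≥1 = s≤s z≤n
    ; L≤N = L<N
    ; L∈ = L+1∈G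
    ; above-L∉ = λ i p → trans (G-other i (>⇒≢ (<-trans s<L+1 p)) (>⇒≢ (<-trans runLow<L+1 p)) (>⇒≢ p)) (above-L∉ i (<-trans (n<1+n L) p))
    ; s≥1 = s′≥1
    ; s∈ = proj₁ s′-spec
    ; below-s∉ = below-s′∉
    ; σ≥1 = s≥1
    ; σ≤L = m≤n⇒m≤1+n s≤L
    ; run∈ = run′∈
    ; gap∉ = trans (cong G runLow≡) runLow∉G
    }
    where
    below-s′∉ : ∀ i → i < s′ → G i ≡ false
    below-s′∉ zero _ = zero∉G
    below-s′∉ (suc i) p = proj₂ (proj₂ s′-spec) (suc i) (s≤s z≤n) p
    run′∈ : ∀ j → suc L ∸ s < j → j ≤ suc L → G j ≡ true
    run′∈ j p q with j ≟ suc L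
    ... | yes refl = L+1∈G
    ... | no ne = trans (G-other j (>⇒≢ (<-trans s<runLow runLow<j)) (>⇒≢ runLow<j) ne) (run∈ j (<-trans gap<runLow runLow<j) (≤-pred (≤∧≢⇒< q ne)))
      where
      runLow<j : runLow < j
      runLow<j = subst (_< j) runLow≡ p
  ¬pent′ : ¬ Pentagonal₂ (suc L) s′ s
  ¬pent′ (e1 , e2) = >⇒≢ s<runLow (trans (sym runLow≡) (suc-injective (trans (sym e1) e2)))

-- After move B (applied to g with shape (L+1, s, σ), s > σ, giving G), G has
-- shape (L, σ, σ′) for some σ′ ≥ σ and it is not pentagonal, so move A
-- applies to it.
module MoveB {g N L s σ} (sp : Shape g N (suc L) s σ) (s≰σ : ¬ s ≤ σ) (¬pent : ¬ Pentagonal₂ (suc L) s σ)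
          (G : Series) (eG : ∀ i → G i ≡ toggle3 (suc L) (suc L ∸ σ) σ g i) where
  open Shape sp
  open ShapeFacts sp
  gap : ℕ
  gap = suc L ∸ σ
  σ<s : σ < s
  σ<s = ≰⇒> s≰σ
  σ<gap : σ < gap
  σ<gap with s ≤? gap
  ... | yes q = <-≤-trans σ<s q
  ... | no nq = ≤-pred (subst (suc σ <_) s≡gap+1 (≤∧≢⇒< σ<s (λ e → ¬pent (s≡gap+1 , sym e))))
    where
    s≡gap+1 : s ≡ suc gap
    s≡gap+1 = ≤-antisym s≤gap+1 (≰⇒> nq)
  gap<L+1 : gap < suc L
  gap<L+1 = gap<L
  σ<L+1 : σ < suc L
  σ<L+1 = <-trans σ<gap gap<L+1
  σ≤L′ : σ ≤ L
  σ≤L′ = ≤-pred σ<L+1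
  gap≡ : gap ≡ suc (L ∸ σ)
  gap≡ = +-∸-assoc 1 σ≤L′
  σ∈G : G σ ≡ true
  σ∈G = trans (eG σ) (trans (toggle3-third (suc L) gap σ g (<⇒≢ σ<L+1) (<⇒≢ σ<gap)) (cong not (below-s∉ σ σ<s)))
  gap∈G : G gap ≡ true
  gap∈G = trans (eG gap) (trans (toggle3-second (suc L) gap σ g (<⇒≢ gap<L+1) (>⇒≢ σ<gap)) (cong not gap∉))
  L+1∉G : G (suc L) ≡ false
  L+1∉G = trans (eG (suc L)) (trans (toggle3-first (suc L) gap σ g (>⇒≢ gap<L+1) (>⇒≢ σ<L+1)) (cong not L∈))
  G-other : ∀ i → i ≢ suc L → i ≢ gap → i ≢ σ → G i ≡ g i
  G-other i i≢L+1 i≢gap i≢σ = trans (eG i) (toggle3-other (suc L) gap σ g i i≢L+1 i≢gap i≢σ)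
  zero∉G : G 0 ≡ false
  zero∉G = trans (G-other 0 (λ ()) (<⇒≢ (<-trans (≤-trans (s≤s z≤n) σ≥1) σ<gap)) (<⇒≢ σ≥1)) zero∉
  gap≤L : gap ≤ L
  gap≤L = ≤-pred gap<L+1
  L≥1′ : 1 ≤ L
  L≥1′ = ≤-trans (≤-trans σ≥1 (<⇒≤ σ<gap)) gap≤L
  L∈G : G L ≡ true
  L∈G with L ≟ gap
  ... | yes e = trans (cong G e) gap∈G
  ... | no ne = trans (G-other L (<⇒≢ (n<1+n L)) ne (>⇒≢ (<-≤-trans σ<gap gap≤L))) (run∈ L (≤∧≢⇒< gap≤L (λ e → ne (sym e))) (n≤1+n L))
  run∈G : ∀ j → L ∸ σ < j → j ≤ L → G j ≡ true
  run∈G j p q with j ≟ gap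
  ... | yes e = trans (cong G e) gap∈G
  ... | no ne = trans (G-other j (<⇒≢ (s≤s q)) ne (>⇒≢ (<-trans σ<gap gap<j))) (run∈ j gap<j (m≤n⇒m≤1+n q))
    where
    gap<j : gap < j
    gap<j = ≤∧≢⇒< (subst (_≤ j) (sym gap≡) p) (λ e → ne (sym e))
  σ′ : ℕ
  σ′ = topRun G L
  σ≤σ′ : σ ≤ σ′
  σ≤σ′ = topRun-≥ G L σ σ≤L′ run∈G
  shape′ : Shape G N L σ σ′
  shape′ = record
    { zero∉ = zero∉G
    ; L≥1 = L≥1′
    ; L≤N = ≤-trans (n≤1+n L) L≤N
    ; L∈ = L∈G
    ; above-L∉ = above-L∉G
    ; s≥1 = σ≥1
    ; s∈ = σ∈G
    ; below-s∉ = λ i p → trans (G-other i (<⇒≢ (<-trans p σ<L+1)) (<⇒≢ (<-trans p σ<gap)) (<⇒≢ p)) (below-s∉ i (<-trans p σ<s))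
    ; σ≥1 = ≤-trans σ≥1 σ≤σ′
    ; σ≤L = topRun-≤ G L
    ; run∈ = topRun-members G L
    ; gap∉ = topRun-gap G L zero∉G
    }
    where
    above-L∉G : ∀ i → L < i → G i ≡ false
    above-L∉G i p with i ≟ suc L
    ... | yes refl = L+1∉G
    ... | no ne = trans (G-other i ne (>⇒≢ (<-≤-trans gap<L+1 p)) (>⇒≢ (<-≤-trans σ<L+1 p))) (above-L∉ i (≤∧≢⇒< p (λ e → ne (sym e))))
  ¬pent′ : ¬ Pentagonal₁ L σ σ′
  ¬pent′ (s≡gap+1 , e2) = <⇒≢ σ<gap (trans s≡gap+1 (trans (cong (λ x → suc (L ∸ x)) (sym e2)) (sym gap≡)))

data Move : Set where
  stay moveA moveB : Move

-- Which move to make on a shape (L, s, σ); L = 0 is the empty set.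
chooseMove : ℕ → ℕ → ℕ → ℕ → Move
chooseMove N zero s σ = stay
chooseMove N (suc L) s σ with s ≤? σ
... | yes _ with pentagonal₁? (suc L) s σ
...   | yes _ = stay
...   | no _ with suc (suc L) ≤? N
...     | yes _ = moveA
...     | no _ = stay
chooseMove N (suc L) s σ | no _ with pentagonal₂? (suc L) s σ
...   | yes _ = stay
...   | no _ = moveB

data MoveCase (N L s σ : ℕ) : Move → Set where
  stay-pentagonal₁ : s ≤ σ → Pentagonal₁ (suc L) s σ → MoveCase N L s σ stay
  stay-blocked : s ≤ σ → ¬ Pentagonal₁ (suc L) s σ → ¬ suc (suc L) ≤ N → MoveCase N L s σ stay
  stay-pentagonal₂ : ¬ s ≤ σ → Pentagonal₂ (suc L) s σ → MoveCase N L s σ stay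
  caseA : s ≤ σ → ¬ Pentagonal₁ (suc L) s σ → suc (suc L) ≤ N → MoveCase N L s σ moveA
  caseB : ¬ s ≤ σ → ¬ Pentagonal₂ (suc L) s σ → MoveCase N L s σ moveB

classifyMove : ∀ N L s σ → MoveCase N L s σ (chooseMove N (suc L) s σ)
classifyMove N L s σ with s ≤? σ
... | yes s≤σ with pentagonal₁? (suc L) s σ
...   | yes pent = stay-pentagonal₁ s≤σ pent
...   | no ¬pent with suc (suc L) ≤? N
...     | yes L+1<N = caseA s≤σ ¬pent L+1<N
...     | no L+1≮N = stay-blocked s≤σ ¬pent L+1≮N
classifyMove N L s σ | no s≰σ with pentagonal₂? (suc L) s σ
...   | yes pent = stay-pentagonal₂ s≰σ pent
...   | no ¬pent = caseB s≰σ ¬pent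

chooseMove-A : ∀ N L s σ → s ≤ σ → ¬ Pentagonal₁ (suc L) s σ → suc (suc L) ≤ N → chooseMove N (suc L) s σ ≡ moveA
chooseMove-A N L s σ s≤σ ¬pent L+1<N with chooseMove N (suc L) s σ | classifyMove N L s σ
... | .stay | stay-pentagonal₁ _ pent = ⊥-elim (¬pent pent)
... | .stay | stay-blocked _ _ L+1≮N = ⊥-elim (L+1≮N L+1<N)
... | .stay | stay-pentagonal₂ s≰σ _ = ⊥-elim (s≰σ s≤σ)
... | .moveA | caseA _ _ _ = refl
... | .moveB | caseB s≰σ _ = ⊥-elim (s≰σ s≤σ)

chooseMove-A' : ∀ N L s σ → 1 ≤ L → s ≤ σ → ¬ Pentagonal₁ L s σ → suc L ≤ N → chooseMove N L s σ ≡ moveA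
chooseMove-A' N (suc L) s σ _ = chooseMove-A N L s σ

chooseMove-B : ∀ N L s σ → ¬ s ≤ σ → ¬ Pentagonal₂ (suc L) s σ → chooseMove N (suc L) s σ ≡ moveB
chooseMove-B N L s σ s≰σ ¬pent with chooseMove N (suc L) s σ | classifyMove N L s σ
... | .stay | stay-pentagonal₁ s≤σ _ = ⊥-elim (s≰σ s≤σ)
... | .stay | stay-blocked s≤σ _ _ = ⊥-elim (s≰σ s≤σ)
... | .stay | stay-pentagonal₂ _ pent = ⊥-elim (¬pent pent)
... | .moveA | caseA s≤σ _ _ = ⊥-elim (s≰σ s≤σ)
... | .moveB | caseB _ _ = refl

applyMove : ∀ {N} → Vec Bool N → Move → ℕ → ℕ → ℕ → Vec Bool N
applyMove v stay L s σ = v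
applyMove v moveA L s σ = toggleAt (toggleAt (toggleAt v s) (suc (L ∸ s))) (suc L)
applyMove v moveB L s σ = toggleAt (toggleAt (toggleAt v L) (L ∸ σ)) σ

franklin : ∀ {N} → Vec Bool N → Vec Bool N
franklin {N} v = applyMove v (chooseMove N (largest (member v) N) (smallest (member v) N) (topRun (member v) (largest (member v) N)))
                    (largest (member v) N) (smallest (member v) N) (topRun (member v) (largest (member v) N))

franklin-params : ∀ {N} (v : Vec Bool N) {L s σ} → largest (member v) N ≡ L → smallest (member v) N ≡ s → topRun (member v) L ≡ σ →
           franklin v ≡ applyMove v (chooseMove N L s σ) L s σ
franklin-params v refl refl refl = refl

franklin-shape : ∀ {N} (v : Vec Bool N) {L s σ} → Shape (member v) N L s σ → franklin v ≡ applyMove v (chooseMove N L s σ) L s σ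
franklin-shape v sp = let (a , b , c) = shape-unique sp in franklin-params v a b c

franklin-empty : ∀ {N} (v : Vec Bool N) → largest (member v) N ≡ 0 → franklin v ≡ v
franklin-empty v largest≡0 = franklin-params v largest≡0 refl refl

pred<j≤⇒≡ : ∀ L j → L ∸ 1 < j → j ≤ L → 1 ≤ L → j ≡ L
pred<j≤⇒≡ (suc L) j x y _ = ≤-antisym y x

shapeOf : ∀ {N} (v : Vec Bool N) → 1 ≤ largest (member v) N →
          Shape (member v) N (largest (member v) N) (smallest (member v) N) (topRun (member v) (largest (member v) N))
shapeOf {N} v p = record
  { zero∉ = member-zero v
  ; L≥1 = p
  ; L≤N = proj₁ (proj₂ L-spec)
  ; L∈ = proj₁ L-spec
  ; above-L∉ = above-L∉′
  ; s≥1 = s≥1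
  ; s∈ = proj₁ s-spec
  ; below-s∉ = below-s∉′
  ; σ≥1 = topRun-≥ g L 1 p (λ j x y → subst (λ j → g j ≡ true) (sym (pred<j≤⇒≡ L j x y p)) (proj₁ L-spec))
  ; σ≤L = topRun-≤ g L
  ; run∈ = topRun-members g L
  ; gap∉ = topRun-gap g L (member-zero v)
  }
  where
  g : Series
  g = member v
  L : ℕ
  L = largest g N
  L-spec : (g L ≡ true) × (L ≤ N) × (∀ i → L < i → i ≤ N → g i ≡ false)
  L-spec = largest-spec g N p
  above-L∉′ : ∀ i → L < i → g i ≡ false
  above-L∉′ i q with i ≤? N
  ... | yes r = proj₂ (proj₂ L-spec) i q r
  ... | no r = member-beyond v i (≰⇒> r)
  s≥1 : 1 ≤ smallest g N
  s≥1 = smallest-positive g N L (proj₁ L-spec) p (proj₁ (proj₂ L-spec))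
  s-spec : (g (smallest g N) ≡ true) × (smallest g N ≤ N) × (∀ i → 1 ≤ i → i < smallest g N → g i ≡ false)
  s-spec = smallest-spec g N s≥1
  below-s∉′ : ∀ i → i < smallest g N → g i ≡ false
  below-s∉′ zero _ = member-zero v
  below-s∉′ (suc i) q = proj₂ (proj₂ s-spec) (suc i) (s≤s z≤n) q

shapeOf-suc : ∀ {N} (v : Vec Bool N) L → largest (member v) N ≡ suc L → Shape (member v) N (suc L) (smallest (member v) N) (topRun (member v) (suc L))
shapeOf-suc {N} v L largest≡ = subst (λ x → Shape (member v) N x (smallest (member v) N) (topRun (member v) x)) largest≡
  (shapeOf v (subst (1 ≤_) (sym largest≡) (s≤s z≤n)))

module FranklinA {N} (v : Vec Bool N) (L s σ : ℕ) (sp : Shape (member v) N (suc L) s σ)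
             (s≤σ : s ≤ σ) (¬pent : ¬ Pentagonal₁ (suc L) s σ) (L<N : suc (suc L) ≤ N) where
  open Shape sp
  open ShapeFacts sp
  low : ℕ
  low = suc (suc L ∸ s)
  top : ℕ
  top = suc (suc L)
  v′ : Vec Bool N
  v′ = toggleAt (toggleAt (toggleAt v s) low) top
  s≤N : s ≤ N
  s≤N = ≤-trans s≤L L≤N
  low≤N : low ≤ N
  low≤N = ≤-trans (∸-monoʳ-< {suc L} {s} {0} s≥1 s≤L) L≤N
  member-v′ : ∀ i → member v′ i ≡ toggle3 s low top (member v) i
  member-v′ = member-toggle3 v s low top s≥1 s≤N (s≤s z≤n) low≤N (s≤s z≤n) L<N
  open MoveA sp s≤σ ¬pent L<N (member v′) member-v′
  involutive : franklin v′ ≡ v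
  involutive = trans (franklin-shape v′ shape′)
        (trans (cong (λ m → applyMove v′ m top s′ s) (chooseMove-B N (suc L) s′ s (<⇒≱ s<s′) ¬pent′))
        (trans (cong (λ x → toggleAt (toggleAt (toggleAt v′ top) x) s) runLow≡) (member-ext _ v restored)))
    where
    restored : ∀ i → member (toggleAt (toggleAt (toggleAt v′ top) low) s) i ≡ member v i
    restored i = trans (member-toggle3 v′ top low s (s≤s z≤n) L<N (s≤s z≤n) low≤N s≥1 s≤N i)
           (trans (toggle3-cong top low s member-v′ i) (toggle3-reverse s low top (member v) i))
  total-preserved : total v′ ≡ total v
  total-preserved = total-moveA v s low top s≥1 s≤N (s≤s z≤n) low≤N (s≤s z≤n) L<N (>⇒≢ s<runLow) (>⇒≢ s<L+1) (>⇒≢ runLow<L+1)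
        s∈ (run∈ low gap<runLow runLow≤L) (above-L∉ top ≤-refl) (trans (+-suc s (suc L ∸ s)) (cong suc (m+[n∸m]≡n s≤L)))
  top∈v′ : member v′ top ≡ true
  top∈v′ = L+1∈G

module FranklinB {N} (v : Vec Bool N) (L s σ : ℕ) (sp : Shape (member v) N (suc L) s σ)
             (s≰σ : ¬ s ≤ σ) (¬pent : ¬ Pentagonal₂ (suc L) s σ) where
  open Shape sp
  open ShapeFacts sp
  hole : ℕ
  hole = suc L ∸ σ
  v′ : Vec Bool N
  v′ = toggleAt (toggleAt (toggleAt v (suc L)) hole) σ
  σ<top : σ < suc L
  σ<top = <-≤-trans (≰⇒> s≰σ) s≤L
  hole≥1 : 1 ≤ hole
  hole≥1 = m<n⇒0<n∸m σ<top
  hole≤N : hole ≤ N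
  hole≤N = ≤-trans (m∸n≤m (suc L) σ) L≤N
  σ≤N : σ ≤ N
  σ≤N = ≤-trans (<⇒≤ σ<top) L≤N
  member-v′ : ∀ i → member v′ i ≡ toggle3 (suc L) hole σ (member v) i
  member-v′ = member-toggle3 v (suc L) hole σ (s≤s z≤n) L≤N hole≥1 hole≤N σ≥1 σ≤N
  open MoveB sp s≰σ ¬pent (member v′) member-v′
  involutive : franklin v′ ≡ v
  involutive = trans (franklin-shape v′ shape′)
        (trans (cong (λ m → applyMove v′ m L σ σ′) (chooseMove-A' N L σ σ′ L≥1′ σ≤σ′ ¬pent′ L≤N))
        (trans (cong (λ x → toggleAt (toggleAt (toggleAt v′ σ) x) (suc L)) (sym gap≡)) (member-ext _ v restored)))
    where
    restored : ∀ i → member (toggleAt (toggleAt (toggleAt v′ σ) hole) (suc L)) i ≡ member v i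
    restored i = trans (member-toggle3 v′ σ hole (suc L) σ≥1 σ≤N hole≥1 hole≤N (s≤s z≤n) L≤N i)
           (trans (toggle3-cong σ hole (suc L) member-v′ i) (toggle3-reverse (suc L) hole σ (member v) i))
  total-preserved : total v′ ≡ total v
  total-preserved = total-moveB v (suc L) hole σ (s≤s z≤n) L≤N hole≥1 hole≤N σ≥1 σ≤N (<⇒≢ gap<L+1) (<⇒≢ σ<L+1) (<⇒≢ σ<gap)
        L∈ gap∉ (below-s∉ σ σ<s) (m∸n+n≡m σ≤L)
  L+1∉v′ : member v′ (suc L) ≡ false
  L+1∉v′ = L+1∉G

franklin-involutive-shape : ∀ {N} (v : Vec Bool N) L s σ → Shape (member v) N (suc L) s σ → franklin (franklin v) ≡ v
franklin-involutive-shape {N} v L s σ sp with chooseMove N (suc L) s σ | classifyMove N L s σ | franklin-shape v sp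
... | .stay | stay-pentagonal₁ _ _ | e = trans (cong franklin e) e
... | .stay | stay-blocked _ _ _ | e = trans (cong franklin e) e
... | .stay | stay-pentagonal₂ _ _ | e = trans (cong franklin e) e
... | .moveA | caseA s≤σ ¬pent L<N | e = trans (cong franklin e) (FranklinA.involutive v L s σ sp s≤σ ¬pent L<N)
... | .moveB | caseB s≰σ ¬pent | e = trans (cong franklin e) (FranklinB.involutive v L s σ sp s≰σ ¬pent)

franklin-involutive : ∀ {N} (v : Vec Bool N) → franklin (franklin v) ≡ v
franklin-involutive {N} v = byLargest (largest (member v) N) refl
  where
  byLargest : ∀ h → largest (member v) N ≡ h → franklin (franklin v) ≡ v
  byLargest zero largest≡ = trans (cong franklin (franklin-empty v largest≡)) (franklin-empty v largest≡)
  byLargest (suc L) largest≡ = franklin-involutive-shape v L _ _ (shapeOf-suc v L largest≡)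

franklin-total-shape : ∀ {N} (v : Vec Bool N) L s σ → Shape (member v) N (suc L) s σ → total (franklin v) ≡ total v
franklin-total-shape {N} v L s σ sp with chooseMove N (suc L) s σ | classifyMove N L s σ | franklin-shape v sp
... | .stay | stay-pentagonal₁ _ _ | e = cong total e
... | .stay | stay-blocked _ _ _ | e = cong total e
... | .stay | stay-pentagonal₂ _ _ | e = cong total e
... | .moveA | caseA s≤σ ¬pent L<N | e = trans (cong total e) (FranklinA.total-preserved v L s σ sp s≤σ ¬pent L<N)
... | .moveB | caseB s≰σ ¬pent | e = trans (cong total e) (FranklinB.total-preserved v L s σ sp s≰σ ¬pent)

franklin-total : ∀ {N} (v : Vec Bool N) → total (franklin v) ≡ total v
franklin-total {N} v = byLargest (largest (member v) N) refl
  where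
  byLargest : ∀ h → largest (member v) N ≡ h → total (franklin v) ≡ total v
  byLargest zero largest≡ = cong total (franklin-empty v largest≡)
  byLargest (suc L) largest≡ = franklin-total-shape v L _ _ (shapeOf-suc v L largest≡)

-- A subset of sum N fixed by Franklin's involution is empty
-- or pentagonal: it is the interval (a, a + σ] with a + 1 = σ or a = σ.
-- Its sum is σ(2a + σ + 1)/2, i.e. N = (a+1)(3a+2)/2 or N = σ(3σ+1)/2, and
-- accordingly 24N + 1 = (6a + 5)² or (6σ + 1)².

Square24 : ℕ → Set
Square24 N = ∃ λ x → x * x ≡ suc (24 * N)

sumMembers : Series → ℕ → ℕ
sumMembers g zero = 0
sumMembers g (suc n) = (if g (suc n) then suc n else 0) + sumMembers g n

sumMembers-cong : ∀ g h n → (∀ i → 1 ≤ i → i ≤ n → g i ≡ h i) → sumMembers g n ≡ sumMembers h n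
sumMembers-cong g h zero e = refl
sumMembers-cong g h (suc n) e rewrite e (suc n) (s≤s z≤n) ≤-refl = cong ((if h (suc n) then suc n else 0) +_) (sumMembers-cong g h n (λ i p q → e i p (m≤n⇒m≤1+n q)))

total-sumMembers : ∀ {N} (v : Vec Bool N) → total v ≡ sumMembers (member v) N
total-sumMembers [] = refl
total-sumMembers {suc N} (b ∷ v) rewrite member-top b v =
  cong ((if b then suc N else 0) +_) (trans (total-sumMembers v) (sumMembers-cong (member v) (member (b ∷ v)) N (λ i p q → sym (member-low b v i (<⇒≢ (s≤s q))))))

interval : ℕ → ℕ → Series
interval a m i = (suc a ≤ᵇ i) ∧ (i ≤ᵇ a + m)

sumMembers-interval-below : ∀ a m n → n ≤ a → sumMembers (interval a m) n ≡ 0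
sumMembers-interval-below a m zero p = refl
sumMembers-interval-below a m (suc n) p rewrite ≤ᵇ-false {suc a} {suc n} (s≤s p) = sumMembers-interval-below a m n (≤-trans (n≤1+n n) p)

sumMembers-interval-inside : ∀ a m k → k ≤ m → 2 * sumMembers (interval a m) (a + k) ≡ k * (2 * a + k + 1)
sumMembers-interval-inside a m zero p rewrite +-identityʳ a | sumMembers-interval-below a m a ≤-refl = refl
sumMembers-interval-inside a m (suc k) p rewrite +-suc a k | ≤ᵇ-true {suc a} {suc (a + k)} (s≤s (m≤m+n a k))
                           | ≤ᵇ-true {suc (a + k)} {a + m} (subst (_≤ a + m) (+-suc a k) (+-monoʳ-≤ a p)) =
  trans (distrib (a + k) (sumMembers (interval a m) (a + k))) (trans (cong (2 * suc (a + k) +_) (sumMembers-interval-inside a m k (≤-trans (n≤1+n k) p))) (regroup a k))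
  where
  distrib : ∀ x w → 2 * (suc x + w) ≡ 2 * suc x + 2 * w
  distrib = solve-∀
  regroup : ∀ a k → 2 * suc (a + k) + k * (2 * a + k + 1) ≡ suc k * (2 * a + suc k + 1)
  regroup = solve-∀

sumMembers-interval-above : ∀ a m d → sumMembers (interval a m) (a + m + d) ≡ sumMembers (interval a m) (a + m)
sumMembers-interval-above a m zero rewrite +-identityʳ (a + m) = refl
sumMembers-interval-above a m (suc d) rewrite +-suc (a + m) d | ≤ᵇ-false {suc (a + m + d)} {a + m} (s≤s (m≤m+n (a + m) d))
                          | ∧-zeroʳ (suc a ≤ᵇ suc (a + m + d)) = sumMembers-interval-above a m d

module PentagonalTotal {N} (v : Vec Bool N) (L s σ : ℕ) (sp : Shape (member v) N L s σ) (s≡gap+1 : s ≡ suc (L ∸ σ)) where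
  open Shape sp
  gap : ℕ
  gap = L ∸ σ
  gap+σ≡L : gap + σ ≡ L
  gap+σ≡L = m∸n+n≡m σ≤L
  member≡interval : ∀ i → 1 ≤ i → i ≤ N → member v i ≡ interval gap σ i
  member≡interval i _ _ with i ≤? gap
  ... | yes p rewrite ≤ᵇ-false {suc gap} {i} (s≤s p) = below-s∉ i (subst (i <_) (sym s≡gap+1) (s≤s p))
  ... | no np with i ≤? L
  ...   | yes q rewrite ≤ᵇ-true {suc gap} {i} (≰⇒> np) | gap+σ≡L | ≤ᵇ-true q = run∈ i (≰⇒> np) q
  ...   | no nq rewrite gap+σ≡L | ≤ᵇ-false (≰⇒> nq) with suc gap ≤ᵇ i
  ...     | true = above-L∉ i (≰⇒> nq)
  ...     | false = above-L∉ i (≰⇒> nq)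
  twice : 2 * total v ≡ σ * (2 * gap + σ + 1)
  twice = trans (cong (2 *_) (trans (total-sumMembers v) (trans (sumMembers-cong (member v) (interval gap σ) N member≡interval)
          (trans (cong (sumMembers (interval gap σ)) N≡) (sumMembers-interval-above gap σ (N ∸ L))))))
          (sumMembers-interval-inside gap σ σ ≤-refl)
    where
    N≡ : N ≡ gap + σ + (N ∸ L)
    N≡ = trans (sym (m+[n∸m]≡n L≤N)) (cong (_+ (N ∸ L)) (sym gap+σ≡L))

square-pentagonal₁ : ∀ a N → 2 * N ≡ suc a * (2 * a + suc a + 1) → Square24 N
square-pentagonal₁ a N twice = 6 * a + 5 , (begin
  (6 * a + 5) * (6 * a + 5)                 ≡⟨ expand a ⟩
  suc (12 * (suc a * (2 * a + suc a + 1)))  ≡⟨ cong (suc ∘ (12 *_)) twice ⟨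
  suc (12 * (2 * N))                        ≡⟨ cong suc (*-assoc 12 2 N) ⟨
  suc (24 * N) ∎)
  where
  open ≡-Reasoning
  expand : ∀ a → (6 * a + 5) * (6 * a + 5) ≡ suc (12 * (suc a * (2 * a + suc a + 1)))
  expand = solve-∀

square-pentagonal₂ : ∀ m N → 2 * N ≡ m * (2 * m + m + 1) → Square24 N
square-pentagonal₂ m N twice = 6 * m + 1 , (begin
  (6 * m + 1) * (6 * m + 1)                 ≡⟨ expand m ⟩
  suc (12 * (m * (2 * m + m + 1)))          ≡⟨ cong (suc ∘ (12 *_)) twice ⟨
  suc (12 * (2 * N))                        ≡⟨ cong suc (*-assoc 12 2 N) ⟨
  suc (24 * N) ∎)
  where
  open ≡-Reasoning
  expand : ∀ m → (6 * m + 1) * (6 * m + 1) ≡ suc (12 * (m * (2 * m + m + 1)))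
  expand = solve-∀

-- A fixed point of weight N with a given shape: the pentagonal cases give a
-- square, the blocked case contradicts s + (L+1) ≤ N, and a move changes v
-- (move A adds L+2, move B removes L+1).
franklin-fixed-shape : ∀ {N} (v : Vec Bool N) L s σ → Shape (member v) N (suc L) s σ →
                       franklin v ≡ v → total v ≡ N → Square24 N
franklin-fixed-shape {N} v L s σ sp fixed total≡N
  with chooseMove N (suc L) s σ | classifyMove N L s σ | franklin-shape v sp
... | .stay | stay-pentagonal₁ _ (s≡gap+1 , s≡σ) | _ =
  square-pentagonal₁ gap N (subst (λ x → 2 * N ≡ x * (2 * gap + x + 1)) (trans (sym s≡σ) s≡gap+1) twiceN)
  where
  open PentagonalTotal v (suc L) s σ sp s≡gap+1
  twiceN : 2 * N ≡ σ * (2 * gap + σ + 1)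
  twiceN = subst (λ y → 2 * y ≡ σ * (2 * gap + σ + 1)) total≡N twice
... | .stay | stay-pentagonal₂ _ (s≡gap+1 , s≡σ+1) | _ =
  square-pentagonal₂ σ N (subst (λ x → 2 * N ≡ σ * (2 * x + σ + 1)) (suc-injective (trans (sym s≡gap+1) s≡σ+1)) twiceN)
  where
  open PentagonalTotal v (suc L) s σ sp s≡gap+1
  twiceN : 2 * N ≡ σ * (2 * gap + σ + 1)
  twiceN = subst (λ y → 2 * y ≡ σ * (2 * gap + σ + 1)) total≡N twice
... | .stay | stay-blocked s≤σ ¬pent L+1≮N | _ =
  ⊥-elim (L+1≮N (subst (suc (suc L) ≤_) total≡N (≤-trans (+-monoˡ-≤ (suc L) s≥1) s+L+1≤total)))
  where
  open Shape sp
  open ShapeFacts sp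
  s<L+1 : s < suc L
  s<L+1 = <-≤-trans (subst (_< s + s) (+-identityʳ s) (+-monoʳ-< s s≥1)) (moveA-room sp s≤σ ¬pent)
  s+L+1≤total : s + suc L ≤ total v
  s+L+1≤total = total-two-members v s (suc L) s≥1 (≤-trans (<⇒≤ s<L+1) L≤N) L≤N s<L+1 s∈ L∈
... | .moveA | caseA s≤σ ¬pent L<N | moved =
  ⊥-elim (true≢false (trans (sym top∈v′) (trans (cong (λ w → member w top) (trans (sym moved) fixed)) (above-L∉ top ≤-refl))))
  where
  open FranklinA v L s σ sp s≤σ ¬pent L<N
  open Shape sp
... | .moveB | caseB s≰σ ¬pent | moved =
  ⊥-elim (true≢false (trans (sym L∈) (trans (cong (λ w → member w (suc L)) (trans (sym fixed) moved)) L+1∉v′)))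
  where
  open FranklinB v L s σ sp s≰σ ¬pent
  open Shape sp

franklin-fixed : ∀ {N} (v : Vec Bool N) → franklin v ≡ v → total v ≡ N → Square24 N
franklin-fixed {N} v fixed total≡N = byLargest (largest (member v) N) refl
  where
  byLargest : ∀ h → largest (member v) N ≡ h → Square24 N
  byLargest zero largest≡ = subst Square24 (trans (sym (total-empty v empty)) total≡N) (1 , refl)
    where
    empty : ∀ i → member v i ≡ false
    empty zero = member-zero v
    empty (suc i) with suc i ≤? N
    ... | yes q = largest-zero (member v) N largest≡ (suc i) (s≤s z≤n) q
    ... | no q = member-beyond v (suc i) (≰⇒> q)
  byLargest (suc L) largest≡ = franklin-fixed-shape v L _ _ (shapeOf-suc v L largest≡) fixed total≡N

-- If φ is an involution of the
-- subsets of {1, …, N} preserving a property P, then the non-fixed points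
-- with P come in pairs {v, φ v}, so the number of subsets with P is odd
-- only if some subset with P is fixed by φ.  The pairs are split by the
-- lexicographic order: exactly one of v < φ v, φ v < v holds.

sameBit : Bool → Bool → Bool
sameBit b c = not (b xor c)

sameVec : ∀ {N} → Vec Bool N → Vec Bool N → Bool
sameVec [] [] = true
sameVec (b ∷ v) (c ∷ w) = sameBit b c ∧ sameVec v w

lexLess : ∀ {N} → Vec Bool N → Vec Bool N → Bool
lexLess [] [] = false
lexLess (false ∷ v) (false ∷ w) = lexLess v w
lexLess (true ∷ v) (true ∷ w) = lexLess v w
lexLess (false ∷ v) (true ∷ w) = true
lexLess (true ∷ v) (false ∷ w) = false

sameVec-refl : ∀ {N} (v : Vec Bool N) → sameVec v v ≡ true
sameVec-refl [] = refl
sameVec-refl (false ∷ v) = sameVec-refl v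
sameVec-refl (true ∷ v) = sameVec-refl v

sameVec-sound : ∀ {N} (v w : Vec Bool N) → sameVec v w ≡ true → v ≡ w
sameVec-sound [] [] e = refl
sameVec-sound (false ∷ v) (false ∷ w) e = cong (false ∷_) (sameVec-sound v w e)
sameVec-sound (true ∷ v) (true ∷ w) e = cong (true ∷_) (sameVec-sound v w e)

sameVec-sym : ∀ {N} (v w : Vec Bool N) → sameVec v w ≡ sameVec w v
sameVec-sym [] [] = refl
sameVec-sym (false ∷ v) (false ∷ w) = sameVec-sym v w
sameVec-sym (true ∷ v) (true ∷ w) = sameVec-sym v w
sameVec-sym (false ∷ v) (true ∷ w) = refl
sameVec-sym (true ∷ v) (false ∷ w) = refl

lexLess-trichotomy : ∀ {N} (v w : Vec Bool N) → sameVec w v ≡ false → indicator (lexLess v w) + indicator (lexLess w v) ≡ 1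
lexLess-trichotomy [] [] ()
lexLess-trichotomy (false ∷ v) (false ∷ w) e = lexLess-trichotomy v w e
lexLess-trichotomy (true ∷ v) (true ∷ w) e = lexLess-trichotomy v w e
lexLess-trichotomy (false ∷ v) (true ∷ w) e = refl
lexLess-trichotomy (true ∷ v) (false ∷ w) e = refl

sumOver-+ : ∀ {X : Set} (f g : X → ℕ) xs → sumOver (λ x → f x + g x) xs ≡ sumOver f xs + sumOver g xs
sumOver-+ f g [] = refl
sumOver-+ f g (x ∷ xs) rewrite sumOver-+ f g xs = +-interchange (f x) (g x) (sumOver f xs) (sumOver g xs)
  where
  +-interchange : ∀ a b c d → (a + b) + (c + d) ≡ (a + c) + (b + d)
  +-interchange = solve-∀

sumOver-swap : ∀ {X Y : Set} (F : X → Y → ℕ) xs ys →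
               sumOver (λ x → sumOver (F x) ys) xs ≡ sumOver (λ y → sumOver (λ x → F x y) xs) ys
sumOver-swap F [] ys = sym (sumOver-zero (λ y → refl) ys)
sumOver-swap F (x ∷ xs) ys = trans (cong (sumOver (F x) ys +_) (sumOver-swap F xs ys))
  (sym (sumOver-+ (F x) (λ y → sumOver (λ x → F x y) xs) ys))

sumOver-delta : ∀ {N} (u : Vec Bool N) (f : Vec Bool N → ℕ) → sumOver (λ w → indicator (sameVec w u) * f w) (subsets N) ≡ f u
sumOver-delta [] f = trans (+-identityʳ (f [] + 0)) (+-identityʳ (f []))
sumOver-delta {suc N} (b ∷ u) f =
  trans (sumOver-++ _ (map (false ∷_) (subsets N)) (map (true ∷_) (subsets N)))
  (trans (cong₂ _+_ (sumOver-map _ (false ∷_) (subsets N)) (sumOver-map _ (true ∷_) (subsets N))) (byHead b))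
  where
  byHead : ∀ b → sumOver (λ w → indicator (sameBit false b ∧ sameVec w u) * f (false ∷ w)) (subsets N) +
                 sumOver (λ w → indicator (sameBit true b ∧ sameVec w u) * f (true ∷ w)) (subsets N) ≡ f (b ∷ u)
  byHead false = trans (cong₂ _+_ (sumOver-delta u (f ∘ (false ∷_))) (sumOver-zero (λ w → refl) (subsets N))) (+-identityʳ (f (false ∷ u)))
  byHead true = trans (cong (_+ sumOver (λ w → indicator (sameVec w u) * f (true ∷ w)) (subsets N)) (sumOver-zero (λ w → refl) (subsets N)))
    (sumOver-delta u (f ∘ (true ∷_)))

sumOver-nonzero : ∀ {X : Set} (f : X → ℕ) xs → sumOver f xs ≢ 0 → ∃ λ x → f x ≢ 0
sumOver-nonzero f [] ne = ⊥-elim (ne refl)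
sumOver-nonzero f (x ∷ xs) ne with f x ≟ 0
... | no fx≢0 = x , fx≢0
... | yes fx≡0 = sumOver-nonzero f xs (λ e → ne (trans (cong (_+ sumOver f xs) fx≡0) e))

indicator-nonzero : ∀ b → indicator b ≢ 0 → b ≡ true
indicator-nonzero true _ = refl
indicator-nonzero false ne = ⊥-elim (ne refl)

-- [P] = [P ∧ fixed] + [P ∧ ¬fixed ∧ v < φ v] + [P ∧ ¬fixed ∧ φ v < v]
indicator-split : ∀ p e l1 l2 → (e ≡ false → indicator l1 + indicator l2 ≡ 1) →
       indicator p ≡ indicator (p ∧ e) + (indicator (p ∧ (not e ∧ l1)) + indicator (p ∧ (not e ∧ l2)))
indicator-split false e l1 l2 h = refl
indicator-split true true l1 l2 h = refl
indicator-split true false l1 l2 h = sym (h refl)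

module InvolutionParity {N : ℕ} (φ : Vec Bool N → Vec Bool N) (φ-involutive : ∀ v → φ (φ v) ≡ v)
                        (P : Vec Bool N → Bool) (P-φ : ∀ v → P (φ v) ≡ P v) where

  delta-swap : ∀ v w → sameVec w (φ v) ≡ sameVec v (φ w)
  delta-swap v w with sameVec w (φ v) in w≡φv
  ... | true rewrite sameVec-sound w (φ v) w≡φv | φ-involutive v = sym (sameVec-refl v)
  ... | false with sameVec v (φ w) in v≡φw
  ...   | false = refl
  ...   | true = ⊥-elim (true≢false (trans (sym (sameVec-refl w)) (trans (cong (sameVec w) (sym φv≡w)) w≡φv)))
    where
    φv≡w : φ v ≡ w
    φv≡w = trans (cong φ (sameVec-sound v (φ w) v≡φw)) (φ-involutive w)

  sumOver-reindex : ∀ h → sumOver (h ∘ φ) (subsets N) ≡ sumOver h (subsets N)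
  sumOver-reindex h = begin
    sumOver (h ∘ φ) (subsets N)
      ≡⟨ sumOver-cong (λ v → sym (sumOver-delta (φ v) h)) (subsets N) ⟩
    sumOver (λ v → sumOver (λ w → indicator (sameVec w (φ v)) * h w) (subsets N)) (subsets N)
      ≡⟨ sumOver-swap (λ v w → indicator (sameVec w (φ v)) * h w) (subsets N) (subsets N) ⟩
    sumOver (λ w → sumOver (λ v → indicator (sameVec w (φ v)) * h w) (subsets N)) (subsets N)
      ≡⟨ sumOver-cong (λ w → sumOver-cong (λ v → cong (λ b → indicator b * h w) (delta-swap v w)) (subsets N)) (subsets N) ⟩
    sumOver (λ w → sumOver (λ v → indicator (sameVec v (φ w)) * h w) (subsets N)) (subsets N)
      ≡⟨ sumOver-cong (λ w → sumOver-delta (φ w) (λ _ → h w)) (subsets N) ⟩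
    sumOver h (subsets N) ∎
    where open ≡-Reasoning

  fixed : Vec Bool N → Bool
  fixed v = sameVec (φ v) v

  fixedWith below above : Vec Bool N → ℕ
  fixedWith v = indicator (P v ∧ fixed v)
  below v = indicator (P v ∧ (not (fixed v) ∧ lexLess v (φ v)))
  above v = indicator (P v ∧ (not (fixed v) ∧ lexLess (φ v) v))

  above≡below∘φ : ∀ v → above v ≡ below (φ v)
  above≡below∘φ v rewrite φ-involutive v | P-φ v | sameVec-sym v (φ v) = refl

  count-split : sumOver (indicator ∘ P) (subsets N) ≡
                sumOver fixedWith (subsets N) + (sumOver below (subsets N) + sumOver below (subsets N))
  count-split = begin
    sumOver (indicator ∘ P) (subsets N)
      ≡⟨ sumOver-cong (λ v → indicator-split (P v) (fixed v) (lexLess v (φ v)) (lexLess (φ v) v) (lexLess-trichotomy v (φ v))) (subsets N) ⟩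
    sumOver (λ v → fixedWith v + (below v + above v)) (subsets N)
      ≡⟨ sumOver-+ fixedWith (λ v → below v + above v) (subsets N) ⟩
    sumOver fixedWith (subsets N) + sumOver (λ v → below v + above v) (subsets N)
      ≡⟨ cong (sumOver fixedWith (subsets N) +_) (sumOver-+ below above (subsets N)) ⟩
    sumOver fixedWith (subsets N) + (sumOver below (subsets N) + sumOver above (subsets N))
      ≡⟨ cong (λ x → sumOver fixedWith (subsets N) + (sumOver below (subsets N) + x))
              (trans (sumOver-cong above≡below∘φ (subsets N)) (sumOver-reindex below)) ⟩
    sumOver fixedWith (subsets N) + (sumOver below (subsets N) + sumOver below (subsets N)) ∎
    where open ≡-Reasoning

  odd-count⇒fixed : isOdd (sumOver (indicator ∘ P) (subsets N)) ≡ true → ∃ λ v → P v ≡ true × φ v ≡ v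
  odd-count⇒fixed odd = v , ∧-left (P v) Pfixed , sameVec-sound (φ v) v (∧-right (P v) Pfixed)
    where
    fixedOdd : isOdd (sumOver fixedWith (subsets N)) ≡ true
    fixedOdd = begin
      isOdd (sumOver fixedWith (subsets N))
        ≡⟨ xor-identityʳ _ ⟨
      isOdd (sumOver fixedWith (subsets N)) xor false
        ≡⟨ cong (isOdd (sumOver fixedWith (subsets N)) xor_) (isOdd-double (sumOver below (subsets N))) ⟨
      isOdd (sumOver fixedWith (subsets N)) xor isOdd (sumOver below (subsets N) + sumOver below (subsets N))
        ≡⟨ isOdd-+ (sumOver fixedWith (subsets N)) _ ⟨
      isOdd (sumOver fixedWith (subsets N) + (sumOver below (subsets N) + sumOver below (subsets N)))
        ≡⟨ cong isOdd count-split ⟨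
      isOdd (sumOver (indicator ∘ P) (subsets N))
        ≡⟨ odd ⟩
      true ∎
      where open ≡-Reasoning
    nonzero : sumOver fixedWith (subsets N) ≢ 0
    nonzero e with trans (sym fixedOdd) (cong isOdd e)
    ... | ()
    witness : ∃ λ v → fixedWith v ≢ 0
    witness = sumOver-nonzero fixedWith (subsets N) nonzero
    v : Vec Bool N
    v = proj₁ witness
    Pfixed : P v ∧ fixed v ≡ true
    Pfixed = indicator-nonzero _ (proj₂ witness)
    ∧-left : ∀ a {b} → a ∧ b ≡ true → a ≡ true
    ∧-left true _ = refl
    ∧-right : ∀ a {b} → a ∧ b ≡ true → b ≡ true
    ∧-right true e = e

odd-count⇒square : ∀ N → isOdd (countSubsets N N) ≡ true → Square24 N
odd-count⇒square N odd with InvolutionParity.odd-count⇒fixed franklin franklin-involutive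
                              (λ v → total v ≡ᵇ N) (λ v → cong (_≡ᵇ N) (franklin-total v)) odd
... | v , total≡N , fixed = franklin-fixed v fixed (≡ᵇ-true (total v) N total≡N)

-- C̄₄,₁(n) odd ⇒ 12n + 1 is a square: n must be even, n = 2N, and then
-- 12n + 1 = 24N + 1.
Cbar41-odd⇒square : ∀ n → isOdd (Cbar41 n) ≡ true → ∃ λ x → x * x ≡ suc (12 * n)
Cbar41-odd⇒square n odd with even-or-odd n
... | N , inj₂ refl with trans (sym odd) (isOdd-Cbar41-odd N)
...   | ()
Cbar41-odd⇒square n odd | N , inj₁ refl
  with odd-count⇒square N (trans (sym (distinctProduct-count N N)) (trans (sym (isOdd-Cbar41-even N)) odd))
... | x , x²≡ = x , trans x²≡ (cong suc (trans (*-assoc 12 2 N) (cong (12 *_) (sym (double≡2* N)))))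

-- x² = 12(pm + r) + 1 = (12r + 1) + 12m·p makes 12r + 1 a square modulo p.
square⇒residue : ∀ p m r x → x * x ≡ suc (12 * (p * m + r)) → QuadraticResidue p (12 * r + 1)
square⇒residue p m r x x²≡ = ℤ.+ x , divides (12 * m) ∣x²-c∣≡
  where
  c : ℕ
  c = 12 * r + 1
  regroup : ∀ p m r → suc (12 * (p * m + r)) ≡ (12 * r + 1) + 12 * m * p
  regroup = solve-∀
  x²≡c+ : x * x ≡ c + 12 * m * p
  x²≡c+ = trans x²≡ (regroup p m r)
  x²-c≡ : ℤ.+ x ℤ.* ℤ.+ x ℤ.- ℤ.+ c ≡ ℤ.+ (12 * m * p)
  x²-c≡ = begin
    ℤ.+ x ℤ.* ℤ.+ x ℤ.- ℤ.+ c  ≡⟨ cong (ℤ._- ℤ.+ c) (pos-* x x) ⟨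
    ℤ.+ (x * x) ℤ.- ℤ.+ c      ≡⟨ m-n≡m⊖n (x * x) c ⟩
    (x * x) ℤ.⊖ c              ≡⟨ ⊖-≥ (subst (c ≤_) (sym x²≡c+) (m≤m+n c (12 * m * p))) ⟩
    ℤ.+ (x * x ∸ c)            ≡⟨ cong (λ y → ℤ.+ (y ∸ c)) x²≡c+ ⟩
    ℤ.+ (c + 12 * m * p ∸ c)   ≡⟨ cong ℤ.+_ (m+n∸m≡n c (12 * m * p)) ⟩
    ℤ.+ (12 * m * p) ∎
    where open ≡-Reasoning
  ∣x²-c∣≡ : ℤ.∣ ℤ.+ x ℤ.* ℤ.+ x ℤ.- ℤ.+ c ∣ ≡ 12 * m * p
  ∣x²-c∣≡ = cong ℤ.∣_∣ x²-c≡

mainTheorem11 : (p r : ℕ) → Prime p → 1 ≤ r → r ≤ p ∸ 1 →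
    QuadraticNonResidue p (12 * r + 1) →
    (m : ℕ) → 2 ∣ Cbar41 (p * m + r)
mainTheorem11 p r _ _ _ nonResidue m with isOdd (Cbar41 (p * m + r)) in parity
... | false = even⇒2∣ (Cbar41 (p * m + r)) parity
... | true with Cbar41-odd⇒square (p * m + r) parity
...   | x , x²≡ = ⊥-elim (nonResidue (square⇒residue p m r x x²≡))
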